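{- Every equatorial graph is regular.
   Context: A cycle $C$ in a graph $G$ is isometric if $d_C(x,y)=d_G(x,y)$ for all $x,y\in V(C)$; the equator is the length of a longest isometric cycle. For $\delta\ge2$, $g\ge3$, $k=\lceil g/2\rceil-1$, the Moore bound is $M(\delta,g)=1+\sum_{i=0}^{k-1}\delta(\delta-1)^i$ for odd $g$ and $M(\delta,g)=2+\sum_{i=1}^{k}2(\delta-1)^i$ for even $g$. An equatorial graph is a finite graph with girth $g$, minimum degree $\delta$ and equator $q>6k+3$ (with $k=\lceil g/2\rceil-1$) whose order is exactly $\frac{q}{g}M(\delta,g)$. -}

module Defs where

open import Data.Nat using (ℕ; zero; suc; _+_; _*_; _∸_; _^_; _≤_; _<_; _≥_; _⊓_; ∣_-_∣; ⌊_/2⌋)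
open import Data.Nat.DivMod using (_%_)
open import Data.Bool using (Bool; true; false; if_then_else_)
open import Data.Fin using (Fin; toℕ)
open import Data.List using (map; allFin)
open import Data.Nat.ListAction using (sum)
open import Data.Product using (Σ; _×_; ∃)
open import Relation.Binary.PropositionalEquality using (_≡_)
open import Relation.Nullary using (¬_)
open import Function.Definitions using (Injective)

record Graph : Set where
  field
    n     : ℕ
    Adj   : Fin n → Fin n → Bool
    sym   : ∀ u v → Adj u v ≡ Adj v u
    irrfl : ∀ v → Adj v v ≡ false

open Graph public

order : Graph → ℕ
order G = n G

deg : (G : Graph) → Fin (n G) → ℕ
deg G v = sum (map (λ u → if Adj G v u then 1 else 0) (allFin (n G)))

data Walk (G : Graph) : Fin (n G) → Fin (n G) → ℕ → Set where
  here : ∀ {x} → Walk G x x 0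
  step : ∀ {x z y l} → Adj G x z ≡ true → Walk G z y l → Walk G x y (suc l)

Dist : (G : Graph) → Fin (n G) → Fin (n G) → ℕ → Set
Dist G x y m = Walk G x y m × (∀ l → l < m → ¬ Walk G x y l)

record Cycle (G : Graph) (L : ℕ) : Set where
  field
    vert  : Fin L → Fin (n G)
    inj   : Injective _≡_ _≡_ vert
    len≥3 : 3 ≤ L
    next  : ∀ (i j : Fin L) → suc (toℕ i) ≡ toℕ j → Adj G (vert i) (vert j) ≡ true
    close : ∀ (i j : Fin L) → toℕ i ≡ L ∸ 1 → toℕ j ≡ 0 → Adj G (vert i) (vert j) ≡ true

open Cycle public

cycDist : (L : ℕ) → Fin L → Fin L → ℕ
cycDist L i j = ∣ toℕ i - toℕ j ∣ ⊓ (L ∸ ∣ toℕ i - toℕ j ∣)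

Isometric : (G : Graph) {L : ℕ} → Cycle G L → Set
Isometric G {L} C = ∀ (i j : Fin L) → Dist G (vert C i) (vert C j) (cycDist L i j)

HasGirth : Graph → ℕ → Set
HasGirth G g = Cycle G g × (∀ L → Cycle G L → g ≤ L)

HasMinDegree : (G : Graph) → ℕ → Set
HasMinDegree G δ = (∃ λ v → deg G v ≡ δ) × (∀ v → δ ≤ deg G v)

HasEquator : Graph → ℕ → Set
HasEquator G q = (Σ (Cycle G q) (Isometric G)) × (∀ L → (C : Cycle G L) → Isometric G C → L ≤ q)

-- k = ⌈g/2⌉ - 1
kOf : ℕ → ℕ
kOf g = ⌊ suc g /2⌋ ∸ 1

sumFrom : ℕ → ℕ → (ℕ → ℕ) → ℕ
sumFrom a zero    f = 0
sumFrom a (suc m) f = f a + sumFrom (suc a) m f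

moore : ℕ → ℕ → ℕ
moore δ g with g % 2
... | 1 = 1 + sumFrom 0 (kOf g) (λ i → δ * (δ ∸ 1) ^ i)
... | _ = 2 + sumFrom 1 (kOf g) (λ i → 2 * (δ ∸ 1) ^ i)

Regular : Graph → Set
Regular G = ∀ u v → deg G u ≡ deg G v

-- equatorial graph with girth g, minimum degree δ, equator q;
-- the order condition |V| = (q/g) M(δ,g) is stated as g·|V| = q·M(δ,g)
record Equatorial (G : Graph) (g δ q : ℕ) : Set where
  field
    δ≥2    : 2 ≤ δ
    g≥3    : 3 ≤ g
    girth  : HasGirth G g
    mindeg : HasMinDegree G δ
    equat  : HasEquator G q
    qbig   : 6 * kOf g + 3 < q
    ord    : g * order G ≡ q * moore δ g

{-# OPTIONS --safe #-}

-- Let C be an isometric cycle of maximal length q, and write g = 2k + 1 + σ with σ ∈ {0, 1}.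
-- As the girth is g, the ball of radius k around a vertex (σ = 0) or an edge (σ = 1) is a tree
-- with at least M(δ, g) vertices, and with more unless its centre has degree δ. As C is isometric
-- and q > 6k + 3, the centres along C whose ball contains a given vertex form an arc of at most g
-- consecutive centres. Counting pairs thus gives q M(δ, g) ≤ g |V|, and the order condition forces
-- equality throughout: the vertices of C have degree δ, and every vertex x lies within k of two
-- vertices of C at distance 2k. Replacing the arc of C between them by a path of length 2k through x
-- gives a cycle that is again isometric (the projection of G onto C, sending x to that arc, is
-- 1-Lipschitz), so the same count applies to it and x has degree δ as well.

module Submission where

open import Data.Bool using (Bool; true; false; _∨_; _∧_; not; if_then_else_)
import Data.Bool as Bool
open import Data.Bool.Properties using (∨-zeroʳ; ∧-identityʳ; ∧-zeroʳ; ¬-not)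
open import Data.Empty using (⊥; ⊥-elim)
open import Data.Fin using (Fin; zero; suc; toℕ)
open import Data.Fin.Properties using (toℕ-injective; toℕ<n; toℕ-fromℕ<; any?)
  renaming (_≟_ to _≟ᶠ_; suc-injective to Fin-suc-injective)
open import Data.List using (tabulate; allFin; _∷_; [])
import Data.List as List
open import Data.List.Properties using (map-tabulate)
open import Data.Nat
open import Data.Nat.DivMod
open import Data.Nat.ListAction using (sum)
open import Data.Nat.Properties
open import Algebra.Properties.CommutativeSemigroup +-commutativeSemigroup using (interchange; xy∙z≈xz∙y)
open import Data.Nat.Tactic.RingSolver using (solve; solve-∀)
open import Data.Product using (Σ-syntax; _×_; _,_; proj₁; proj₂)
open import Data.Sum using (_⊎_; inj₁; inj₂)
open import Function using (_∘_; id)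
open import Relation.Binary.Definitions using (tri<; tri≈; tri>)
open import Relation.Binary.PropositionalEquality
open import Relation.Nullary using (¬_; Dec; yes; no)
open import Relation.Nullary.Decidable using (⌊_⌋)
open import Defs renaming (sym to Adj-sym) hiding (n)

-- Indicators and finite sums

𝟙 : Bool → ℕ
𝟙 true  = 1
𝟙 false = 0

true≢false : ∀ {b} → b ≡ true → b ≡ false → ⊥
true≢false refl ()

true-or-false : ∀ b → b ≡ true ⊎ b ≡ false
true-or-false true  = inj₁ refl
true-or-false false = inj₂ refl

∨-true : ∀ {a b} → a ∨ b ≡ true → a ≡ true ⊎ b ≡ true
∨-true {true}  _ = inj₁ refl
∨-true {false} e = inj₂ e

∨-trueˡ : ∀ {a b} → a ≡ true → a ∨ b ≡ true
∨-trueˡ refl = refl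

∨-trueʳ : ∀ {a b} → b ≡ true → a ∨ b ≡ true
∨-trueʳ {a} refl = ∨-zeroʳ a

∧-true : ∀ {a b} → a ∧ b ≡ true → a ≡ true × b ≡ true
∧-true {true} {true} _ = refl , refl

not-true : ∀ {a} → not a ≡ true → a ≡ false
not-true {false} _ = refl

sumℕ : ℕ → (ℕ → ℕ) → ℕ
sumℕ zero    f = 0
sumℕ (suc m) f = f 0 + sumℕ m (f ∘ suc)

sumFin : (m : ℕ) → (Fin m → ℕ) → ℕ
sumFin zero    f = 0
sumFin (suc m) f = f zero + sumFin m (f ∘ suc)

sumℕ-snoc : ∀ m f → sumℕ (suc m) f ≡ sumℕ m f + f m
sumℕ-snoc zero    f = +-identityʳ (f 0)
sumℕ-snoc (suc m) f = trans (cong (f 0 +_) (sumℕ-snoc m (f ∘ suc))) (sym (+-assoc (f 0) _ _))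

sumℕ-cong : ∀ m {f h} → (∀ i → i < m → f i ≡ h i) → sumℕ m f ≡ sumℕ m h
sumℕ-cong zero    e = refl
sumℕ-cong (suc m) e = cong₂ _+_ (e 0 z<s) (sumℕ-cong m (λ i lt → e (suc i) (s<s lt)))

sumℕ-mono : ∀ m {f h} → (∀ i → i < m → f i ≤ h i) → sumℕ m f ≤ sumℕ m h
sumℕ-mono zero    e = z≤n
sumℕ-mono (suc m) e = +-mono-≤ (e 0 z<s) (sumℕ-mono m (λ i lt → e (suc i) (s<s lt)))

sumℕ-+ : ∀ m f h → sumℕ m (λ i → f i + h i) ≡ sumℕ m f + sumℕ m h
sumℕ-+ zero    f h = refl
sumℕ-+ (suc m) f h = trans (cong (f 0 + h 0 +_) (sumℕ-+ m (f ∘ suc) (h ∘ suc))) (interchange (f 0) (h 0) _ _)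

sumℕ-const : ∀ m c → sumℕ m (λ _ → c) ≡ m * c
sumℕ-const zero    c = refl
sumℕ-const (suc m) c = cong (c +_) (sumℕ-const m c)

sumℕ-*ˡ : ∀ m c f → sumℕ m (λ i → c * f i) ≡ c * sumℕ m f
sumℕ-*ˡ zero    c f = sym (*-zeroʳ c)
sumℕ-*ˡ (suc m) c f = trans (cong (c * f 0 +_) (sumℕ-*ˡ m c (f ∘ suc))) (sym (*-distribˡ-+ c (f 0) _))

sumℕ≡0⇒≡0 : ∀ m f → sumℕ m f ≡ 0 → ∀ i → i < m → f i ≡ 0
sumℕ≡0⇒≡0 (suc m) f eq zero    _         = m+n≡0⇒m≡0 (f 0) eq
sumℕ≡0⇒≡0 (suc m) f eq (suc i) (s≤s lt) = sumℕ≡0⇒≡0 m (f ∘ suc) (m+n≡0⇒n≡0 (f 0) eq) i lt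

sumℕ-rotate-suc : ∀ q (h : ℕ → ℕ) → (∀ i → h (i + q) ≡ h i) → ∀ b →
                  sumℕ q (λ t → h (suc b + t)) ≡ sumℕ q (λ t → h (b + t))
sumℕ-rotate-suc zero    h periodic b = refl
sumℕ-rotate-suc (suc p) h periodic b = begin
  sumℕ (suc p) (λ t → h (suc b + t))            ≡⟨ sumℕ-snoc p _ ⟩
  sumℕ p (λ t → h (suc b + t)) + h (suc b + p)  ≡⟨ cong (sumℕ p (λ t → h (suc b + t)) +_)
                                                           (trans (cong h (sym (+-suc b p))) (periodic b)) ⟩
  sumℕ p (λ t → h (suc b + t)) + h b            ≡⟨ +-comm _ (h b) ⟩
  h b + sumℕ p (λ t → h (suc b + t))            ≡⟨ cong₂ _+_ (cong h (sym (+-identityʳ b)))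
                                                           (sumℕ-cong p (λ t _ → cong h (sym (+-suc b t)))) ⟩
  sumℕ (suc p) (λ t → h (b + t))                ∎
  where open ≡-Reasoning

sumℕ-rotate : ∀ q (h : ℕ → ℕ) → (∀ i → h (i + q) ≡ h i) → ∀ b → sumℕ q (λ t → h (b + t)) ≡ sumℕ q h
sumℕ-rotate q h periodic zero    = refl
sumℕ-rotate q h periodic (suc b) = trans (sumℕ-rotate-suc q h periodic b) (sumℕ-rotate q h periodic b)

sumℕ-𝟙-interval-⊓ : ∀ m lo hi (u : ℕ → Bool) → (∀ t → t < m → u t ≡ true → lo ≤ t × t < hi) →
                    sumℕ m (𝟙 ∘ u) ≤ (m ⊓ hi) ∸ lo
sumℕ-𝟙-interval-⊓ zero    lo hi u supp = z≤n
sumℕ-𝟙-interval-⊓ (suc m) lo hi u supp with u m in um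
... | false = begin
    sumℕ (suc m) (𝟙 ∘ u)   ≡⟨ trans (sumℕ-snoc m _) (cong (λ b → sumℕ m (𝟙 ∘ u) + 𝟙 b) um) ⟩
    sumℕ m (𝟙 ∘ u) + 0     ≡⟨ +-identityʳ _ ⟩
    sumℕ m (𝟙 ∘ u)         ≤⟨ sumℕ-𝟙-interval-⊓ m lo hi u (λ t t<m → supp t (m≤n⇒m≤1+n t<m)) ⟩
    (m ⊓ hi) ∸ lo          ≤⟨ ∸-monoˡ-≤ lo (⊓-monoˡ-≤ hi (n≤1+n m)) ⟩
    (suc m ⊓ hi) ∸ lo      ∎
  where open ≤-Reasoning
... | true = begin
    sumℕ (suc m) (𝟙 ∘ u)   ≡⟨ trans (sumℕ-snoc m _) (cong (λ b → sumℕ m (𝟙 ∘ u) + 𝟙 b) um) ⟩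
    sumℕ m (𝟙 ∘ u) + 1     ≤⟨ +-monoˡ-≤ 1 (sumℕ-𝟙-interval-⊓ m lo hi u (λ t t<m → supp t (m≤n⇒m≤1+n t<m))) ⟩
    (m ⊓ hi) ∸ lo + 1      ≡⟨ cong (λ x → x ∸ lo + 1) (m≤n⇒m⊓n≡m (<⇒≤ m<hi)) ⟩
    m ∸ lo + 1             ≡⟨ trans (sym (+-∸-comm 1 lo≤m)) (cong (_∸ lo) (+-comm m 1)) ⟩
    suc m ∸ lo             ≡⟨ cong (_∸ lo) (sym (m≤n⇒m⊓n≡m m<hi)) ⟩
    (suc m ⊓ hi) ∸ lo      ∎
  where
  open ≤-Reasoning
  lo≤m : lo ≤ m
  lo≤m = proj₁ (supp m ≤-refl um)
  m<hi : m < hi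
  m<hi = proj₂ (supp m ≤-refl um)

sumℕ-𝟙-interval : ∀ m lo hi (u : ℕ → Bool) → (∀ t → t < m → u t ≡ true → lo ≤ t × t < hi) →
                  sumℕ m (𝟙 ∘ u) ≤ hi ∸ lo
sumℕ-𝟙-interval m lo hi u supp = ≤-trans (sumℕ-𝟙-interval-⊓ m lo hi u supp) (∸-monoˡ-≤ lo (m⊓n≤n m hi))

powerSum : ℕ → ℕ → ℕ
powerSum r m = sumℕ m (r ^_)

sumFin-cong : ∀ m {f h : Fin m → ℕ} → (∀ i → f i ≡ h i) → sumFin m f ≡ sumFin m h
sumFin-cong zero    e = refl
sumFin-cong (suc m) e = cong₂ _+_ (e zero) (sumFin-cong m (e ∘ suc))

sumFin-mono : ∀ m {f h : Fin m → ℕ} → (∀ i → f i ≤ h i) → sumFin m f ≤ sumFin m h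
sumFin-mono zero    e = z≤n
sumFin-mono (suc m) e = +-mono-≤ (e zero) (sumFin-mono m (e ∘ suc))

sumFin-const : ∀ m c → sumFin m (λ _ → c) ≡ m * c
sumFin-const zero    c = refl
sumFin-const (suc m) c = cong (c +_) (sumFin-const m c)

sumFin-zero : ∀ m → sumFin m (λ _ → 0) ≡ 0
sumFin-zero m = trans (sumFin-const m 0) (*-zeroʳ m)

sumFin-≤-const : ∀ m {f : Fin m → ℕ} c → (∀ i → f i ≤ c) → sumFin m f ≤ m * c
sumFin-≤-const m {f} c e = subst (sumFin m f ≤_) (sumFin-const m c) (sumFin-mono m e)

sumFin-term≤ : ∀ m (f : Fin m → ℕ) i → f i ≤ sumFin m f
sumFin-term≤ (suc m) f zero    = m≤m+n (f zero) _
sumFin-term≤ (suc m) f (suc i) = ≤-trans (sumFin-term≤ m (f ∘ suc) i) (m≤n+m _ (f zero))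

sumFin-two-terms≤ : ∀ m (f : Fin m → ℕ) {i j} → i ≢ j → f i + f j ≤ sumFin m f
sumFin-two-terms≤ (suc m) f {zero}  {zero}  i≢j = ⊥-elim (i≢j refl)
sumFin-two-terms≤ (suc m) f {zero}  {suc j} _   = +-monoʳ-≤ (f zero) (sumFin-term≤ m (f ∘ suc) j)
sumFin-two-terms≤ (suc m) f {suc i} {zero}  _   =
  subst (_≤ sumFin (suc m) f) (+-comm (f zero) (f (suc i))) (+-monoʳ-≤ (f zero) (sumFin-term≤ m (f ∘ suc) i))
sumFin-two-terms≤ (suc m) f {suc i} {suc j} i≢j =
  ≤-trans (sumFin-two-terms≤ m (f ∘ suc) (i≢j ∘ cong suc)) (m≤n+m _ (f zero))

sumFin-single : ∀ m (f : Fin m → ℕ) y → (∀ x → x ≢ y → f x ≡ 0) → sumFin m f ≡ f y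
sumFin-single (suc m) f zero    vanish =
  trans (cong (f zero +_) (trans (sumFin-cong m (λ x → vanish (suc x) (λ ()))) (sumFin-zero m))) (+-identityʳ _)
sumFin-single (suc m) f (suc y) vanish =
  trans (cong₂ _+_ (vanish zero (λ ())) (sumFin-single m (f ∘ suc) y (λ x x≢y → vanish (suc x) (x≢y ∘ Fin-suc-injective)))) refl

sumFin-+ : ∀ m (f h : Fin m → ℕ) → sumFin m (λ i → f i + h i) ≡ sumFin m f + sumFin m h
sumFin-+ zero    f h = refl
sumFin-+ (suc m) f h = trans (cong (f zero + h zero +_) (sumFin-+ m (f ∘ suc) (h ∘ suc))) (interchange (f zero) (h zero) _ _)

sumFin-*ʳ : ∀ m (f : Fin m → ℕ) c → sumFin m (λ i → f i * c) ≡ sumFin m f * c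
sumFin-*ʳ zero    f c = refl
sumFin-*ʳ (suc m) f c = trans (cong (f zero * c +_) (sumFin-*ʳ m (f ∘ suc) c)) (sym (*-distribʳ-+ c (f zero) _))

sumFin-swap : ∀ m m′ (F : Fin m → Fin m′ → ℕ) →
              sumFin m (λ v → sumFin m′ (F v)) ≡ sumFin m′ (λ x → sumFin m (λ v → F v x))
sumFin-swap zero    m′ F = sym (sumFin-zero m′)
sumFin-swap (suc m) m′ F = trans (cong (sumFin m′ (F zero) +_) (sumFin-swap m m′ (F ∘ suc)))
                                 (sym (sumFin-+ m′ (F zero) (λ x → sumFin m (λ v → F (suc v) x))))

sumFin-sumℕ-swap : ∀ m q (F : Fin m → ℕ → ℕ) →
                   sumFin m (λ w → sumℕ q (F w)) ≡ sumℕ q (λ i → sumFin m (λ w → F w i))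
sumFin-sumℕ-swap zero    q F = sym (trans (sumℕ-const q 0) (*-zeroʳ q))
sumFin-sumℕ-swap (suc m) q F = trans (cong (sumℕ q (F zero) +_) (sumFin-sumℕ-swap m q (F ∘ suc)))
                                     (sym (sumℕ-+ q (F zero) (λ i → sumFin m (λ w → F (suc w) i))))

sumFin-tight : ∀ m (f : Fin m → ℕ) c → (∀ i → f i ≤ c) → m * c ≤ sumFin m f → ∀ i → f i ≡ c
sumFin-tight (suc m) f c bounded total zero    =
  ≤-antisym (bounded zero) (+-cancelʳ-≤ _ _ _ (≤-trans (+-monoʳ-≤ c (sumFin-≤-const m c (bounded ∘ suc))) total))
sumFin-tight (suc m) f c bounded total (suc i) =
  sumFin-tight m (f ∘ suc) c (bounded ∘ suc) (+-cancelˡ-≤ c _ _ (≤-trans total (+-monoˡ-≤ _ (bounded zero)))) i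

module _ {P : ℕ → Set} (P? : ∀ t → Dec (P t)) where

  minimal-or-none : ∀ m → (Σ[ t ∈ ℕ ] t < m × P t × (∀ s → s < t → ¬ P s)) ⊎ (∀ t → t < m → ¬ P t)
  minimal-or-none zero = inj₂ (λ t ())
  minimal-or-none (suc m) with minimal-or-none m
  ... | inj₁ (t , t<m , Pt , before) = inj₁ (t , m≤n⇒m≤1+n t<m , Pt , before)
  ... | inj₂ none with P? m
  ...   | yes Pm = inj₁ (m , ≤-refl , Pm , none)
  ...   | no ¬Pm = inj₂ (λ t t<1+m → up-to-m t (m≤n⇒m<n∨m≡n (≤-pred t<1+m)))
    where
    up-to-m : ∀ t → t < m ⊎ t ≡ m → ¬ P t
    up-to-m t (inj₁ t<m)  = none t t<m
    up-to-m t (inj₂ refl) = ¬Pm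

-- Distance on the cycle ℤ/q

module Modulo (q : ℕ) where

  infix 4 _≡ₘ_

  _≡ₘ_ : ℕ → ℕ → Set
  x ≡ₘ y = Σ[ a ∈ ℕ ] Σ[ b ∈ ℕ ] x + a * q ≡ y + b * q

  ≡⇒≡ₘ : ∀ {x y} → x ≡ y → x ≡ₘ y
  ≡⇒≡ₘ refl = 0 , 0 , refl

  ≡ₘ-refl : ∀ {x} → x ≡ₘ x
  ≡ₘ-refl = ≡⇒≡ₘ refl

  ≡ₘ-sym : ∀ {x y} → x ≡ₘ y → y ≡ₘ x
  ≡ₘ-sym (a , b , e) = b , a , sym e

  ≡ₘ-trans : ∀ {x y z} → x ≡ₘ y → y ≡ₘ z → x ≡ₘ z
  ≡ₘ-trans {x} {y} {z} (a , b , e₁) (c , d , e₂) = a + c , b + d , (begin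
    x + (a + c) * q    ≡⟨ solve (x ∷ a ∷ c ∷ q ∷ []) ⟩
    x + a * q + c * q  ≡⟨ cong (_+ c * q) e₁ ⟩
    y + b * q + c * q  ≡⟨ solve (y ∷ b ∷ c ∷ q ∷ []) ⟩
    y + c * q + b * q  ≡⟨ cong (_+ b * q) e₂ ⟩
    z + d * q + b * q  ≡⟨ solve (z ∷ d ∷ b ∷ q ∷ []) ⟩
    z + (b + d) * q    ∎)
    where open ≡-Reasoning

  ≡ₘ-+ʳ : ∀ {x y} c → x ≡ₘ y → x + c ≡ₘ y + c
  ≡ₘ-+ʳ {x} {y} c (a , b , e) = a , b , (begin
    x + c + a * q  ≡⟨ solve (x ∷ c ∷ a ∷ q ∷ []) ⟩
    x + a * q + c  ≡⟨ cong (_+ c) e ⟩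
    y + b * q + c  ≡⟨ solve (y ∷ b ∷ q ∷ c ∷ []) ⟩
    y + c + b * q  ∎)
    where open ≡-Reasoning

  ≡ₘ-+ˡ : ∀ {x y} c → x ≡ₘ y → c + x ≡ₘ c + y
  ≡ₘ-+ˡ {x} {y} c h = subst₂ _≡ₘ_ (+-comm x c) (+-comm y c) (≡ₘ-+ʳ c h)

  ≡ₘ-cancelˡ : ∀ {x y} c → c + x ≡ₘ c + y → x ≡ₘ y
  ≡ₘ-cancelˡ {x} {y} c (a , b , e) =
    a , b , +-cancelˡ-≡ c _ _ (trans (sym (+-assoc c x _)) (trans e (+-assoc c y _)))

  ≡ₘ-cancelʳ : ∀ {x y} c → x + c ≡ₘ y + c → x ≡ₘ y
  ≡ₘ-cancelʳ {x} {y} c h = ≡ₘ-cancelˡ c (subst₂ _≡ₘ_ (+-comm x c) (+-comm y c) h)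

  x+q≡ₘx : ∀ x → x + q ≡ₘ x
  x+q≡ₘx x = 0 , 1 , trans (+-identityʳ _) (cong (x +_) (sym (+-identityʳ q)))

  private
    ≡ₘ-one-sided : ∀ {x y a b} → a ≤ b → x < y + q → x + a * q ≡ y + b * q → x ≡ y
    ≡ₘ-one-sided {x} {y} {a} {b} a≤b x<y+q e = below-period (b ∸ a) (+-cancelʳ-≡ (a * q) _ _ (begin
      x + a * q                  ≡⟨ e ⟩
      y + b * q                  ≡⟨ cong (λ b → y + b * q) (sym (m∸n+n≡m a≤b)) ⟩
      y + (b ∸ a + a) * q        ≡⟨ cong (y +_) (*-distribʳ-+ q (b ∸ a) a) ⟩
      y + ((b ∸ a) * q + a * q)  ≡⟨ +-assoc y _ _ ⟨
      y + (b ∸ a) * q + a * q    ∎))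
      where
      open ≡-Reasoning
      below-period : ∀ d → x ≡ y + d * q → x ≡ y
      below-period zero    e = trans e (+-identityʳ y)
      below-period (suc d) e = ⊥-elim (<⇒≱ x<y+q (subst (y + q ≤_) (sym e) (+-monoʳ-≤ y (m≤m+n q (d * q)))))

  ≡ₘ-close⇒≡ : ∀ {x y} → x < y + q → y < x + q → x ≡ₘ y → x ≡ y
  ≡ₘ-close⇒≡ {x} {y} x<y+q y<x+q (a , b , e) with ≤-total a b
  ... | inj₁ a≤b = ≡ₘ-one-sided a≤b x<y+q e
  ... | inj₂ b≤a = sym (≡ₘ-one-sided b≤a y<x+q (sym e))

  ≡ₘ-small⇒≡ : ∀ {x y} → x < q → y < q → x ≡ₘ y → x ≡ y
  ≡ₘ-small⇒≡ {x} {y} x<q y<q = ≡ₘ-close⇒≡ (<-≤-trans x<q (m≤n+m q y)) (<-≤-trans y<q (m≤n+m q x))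

  ≡ₘ0⇒≡0 : ∀ {x} → x < q → x ≡ₘ 0 → x ≡ 0
  ≡ₘ0⇒≡0 x<q = ≡ₘ-small⇒≡ x<q (≤-<-trans z≤n x<q)

  Close : ℕ → ℕ → ℕ → Set
  Close m i j = Σ[ s ∈ ℕ ] s ≤ m × (i + s ≡ₘ j ⊎ j + s ≡ₘ i)

  Close-refl : ∀ {i} → Close 0 i i
  Close-refl {i} = 0 , z≤n , inj₁ (≡⇒≡ₘ (+-identityʳ i))

  Close-sym : ∀ {m i j} → Close m i j → Close m j i
  Close-sym (s , s≤m , inj₁ c) = s , s≤m , inj₂ c
  Close-sym (s , s≤m , inj₂ c) = s , s≤m , inj₁ c

  Close-mono : ∀ {m m′ i j} → m ≤ m′ → Close m i j → Close m′ i j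
  Close-mono m≤m′ (s , s≤m , c) = s , ≤-trans s≤m m≤m′ , c

  Close-resp-≡ₘ : ∀ {m i i′ j j′} → i ≡ₘ i′ → j ≡ₘ j′ → Close m i j → Close m i′ j′
  Close-resp-≡ₘ i≡i′ j≡j′ (s , s≤m , inj₁ c) = s , s≤m , inj₁ (≡ₘ-trans (≡ₘ-+ʳ s (≡ₘ-sym i≡i′)) (≡ₘ-trans c j≡j′))
  Close-resp-≡ₘ i≡i′ j≡j′ (s , s≤m , inj₂ c) = s , s≤m , inj₂ (≡ₘ-trans (≡ₘ-+ʳ s (≡ₘ-sym j≡j′)) (≡ₘ-trans c i≡i′))

  Close-+ˡ : ∀ {m} a {i j} → Close m i j → Close m (a + i) (a + j)
  Close-+ˡ a {i} {j} (s , s≤m , inj₁ c) = s , s≤m , inj₁ (subst (_≡ₘ a + j) (sym (+-assoc a i s)) (≡ₘ-+ˡ a c))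
  Close-+ˡ a {i} {j} (s , s≤m , inj₂ c) = s , s≤m , inj₂ (subst (_≡ₘ a + i) (sym (+-assoc a j s)) (≡ₘ-+ˡ a c))

  Close-cancelˡ : ∀ {m} a {i j} → Close m (a + i) (a + j) → Close m i j
  Close-cancelˡ a {i} {j} (s , s≤m , inj₁ c) = s , s≤m , inj₁ (≡ₘ-cancelˡ a (subst (_≡ₘ a + j) (+-assoc a i s) c))
  Close-cancelˡ a {i} {j} (s , s≤m , inj₂ c) = s , s≤m , inj₂ (≡ₘ-cancelˡ a (subst (_≡ₘ a + i) (+-assoc a j s) c))

  Close-+ʳ : ∀ {m} a {i j} → Close m i j → Close m (i + a) (j + a)
  Close-+ʳ a {i} {j} c = Close-resp-≡ₘ (≡⇒≡ₘ (+-comm a i)) (≡⇒≡ₘ (+-comm a j)) (Close-+ˡ a c)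

  private
    ≡ₘ⇒Close : ∀ {i k} s t → i + s ≡ₘ k + t → Close (s + t) i k
    ≡ₘ⇒Close {i} {k} s t c with ≤-total t s
    ... | inj₁ t≤s = s ∸ t , ≤-trans (m∸n≤m s t) (m≤m+n s t) ,
                     inj₁ (≡ₘ-cancelʳ t (subst (_≡ₘ k + t) (trans (cong (i +_) (sym (m∸n+n≡m t≤s))) (sym (+-assoc i _ t))) c))
    ... | inj₂ s≤t = t ∸ s , ≤-trans (m∸n≤m t s) (m≤n+m t s) ,
                     inj₂ (≡ₘ-cancelʳ s (subst (_≡ₘ i + s) (trans (cong (k +_) (sym (m∸n+n≡m s≤t))) (sym (+-assoc k _ s)))
                                               (≡ₘ-sym c)))

  Close-trans : ∀ {m₁ m₂ i j k} → Close m₁ i j → Close m₂ j k → Close (m₁ + m₂) i k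
  Close-trans {m₁} {m₂} {i} {j} {k} (s , s≤ , c₁) (t , t≤ , c₂) = Close-mono (+-mono-≤ s≤ t≤) (combine c₁ c₂)
    where
    combine : i + s ≡ₘ j ⊎ j + s ≡ₘ i → j + t ≡ₘ k ⊎ k + t ≡ₘ j → Close (s + t) i k
    combine (inj₁ c₁) (inj₁ c₂) = s + t , ≤-refl , inj₁ (subst (_≡ₘ k) (+-assoc i s t) (≡ₘ-trans (≡ₘ-+ʳ t c₁) c₂))
    combine (inj₂ c₁) (inj₂ c₂) = s + t , ≤-refl ,
                                  inj₂ (subst (_≡ₘ i) (trans (+-assoc k t s) (cong (k +_) (+-comm t s)))
                                              (≡ₘ-trans (≡ₘ-+ʳ s c₂) c₁))
    combine (inj₁ c₁) (inj₂ c₂) = ≡ₘ⇒Close s t (≡ₘ-trans c₁ (≡ₘ-sym c₂))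
    combine (inj₂ c₁) (inj₁ c₂) = subst (λ m → Close m i k) (+-comm t s)
      (≡ₘ⇒Close t s (≡ₘ-trans (≡ₘ-+ʳ t (≡ₘ-sym c₁)) (subst (_≡ₘ k + s) (xy∙z≈xz∙y j t s) (≡ₘ-+ʳ s c₂))))

  Close-lift : ∀ {m t t′} → t + m < q → t′ + m < q → Close m t t′ → t′ ≤ t + m
  Close-lift {m} {t} {t′} t+m<q t′+m<q (s , s≤m , inj₁ c) = subst (_≤ t + m) t+s≡t′ (+-monoʳ-≤ t s≤m)
    where
    t+s≡t′ : t + s ≡ t′
    t+s≡t′ = ≡ₘ-small⇒≡ (≤-<-trans (+-monoʳ-≤ t s≤m) t+m<q) (≤-<-trans (m≤m+n t′ m) t′+m<q) c
  Close-lift {m} {t} {t′} t+m<q t′+m<q (s , s≤m , inj₂ c) = ≤-trans (subst (t′ ≤_) t′+s≡t (m≤m+n t′ s)) (m≤m+n t m)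
    where
    t′+s≡t : t′ + s ≡ t
    t′+s≡t = ≡ₘ-small⇒≡ (≤-<-trans (+-monoʳ-≤ t′ s≤m) t′+m<q) (≤-<-trans (m≤m+n t m) t+m<q) c

  Close-window : ∀ {m p t} → m < p → p + m < q → t ≤ q → Close m t p → p ∸ m ≤ t × t ≤ p + m
  Close-window {m} {p} {t} m<p p+m<q t≤q (s , s≤m , inj₁ c) =
    m≤n+o⇒m∸n≤o p m (subst (_≤ m + t) t+s≡p (≤-trans (+-monoʳ-≤ t s≤m) (≤-reflexive (+-comm t m)))) ,
    ≤-trans (subst (t ≤_) t+s≡p (m≤m+n t s)) (m≤m+n p m)
    where
    t+s≡p : t + s ≡ p
    t+s≡p = ≡ₘ-close⇒≡ (subst (t + s <_) (+-comm q p) (+-mono-≤-< t≤q (≤-<-trans s≤m m<p)))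
                        (<-≤-trans (≤-<-trans (m≤m+n p m) p+m<q) (m≤n+m q (t + s))) c
  Close-window {m} {p} {t} m<p p+m<q t≤q (s , s≤m , inj₂ c) =
    ≤-trans (m∸n≤m p m) (subst (p ≤_) p+s≡t (m≤m+n p s)) , subst (_≤ p + m) p+s≡t (+-monoʳ-≤ p s≤m)
    where
    p+s≡t : p + s ≡ t
    p+s≡t = ≡ₘ-close⇒≡ (<-≤-trans (≤-<-trans (+-monoʳ-≤ p s≤m) p+m<q) (m≤n+m q t))
                        (≤-<-trans t≤q (m<n+m q (≤-trans (<-≤-trans z<s m<p) (m≤m+n p s)))) c

  private
    cancel-to-0 : ∀ a {x y} → a + x ≡ₘ y → y ≡ a → x ≡ₘ 0
    cancel-to-0 a {x} c refl = ≡ₘ-cancelˡ a (subst (a + x ≡ₘ_) (sym (+-identityʳ a)) c)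

  Close-offset : ∀ {m a d} → d + d < q → Close m a (a + d) → d ≤ m
  Close-offset {m} {a} {d} 2d<q (s , s≤m , inj₁ c) with d ≤? s
  ... | yes d≤s = ≤-trans d≤s s≤m
  ... | no d≰s  = ⊥-elim (<-irrefl (≡ₘ-small⇒≡ (<-trans (≰⇒> d≰s) d<q) d<q (≡ₘ-cancelˡ a c)) (≰⇒> d≰s))
    where
    d<q : d < q
    d<q = ≤-<-trans (m≤m+n d d) 2d<q
  Close-offset {m} {a} {d} 2d<q (s , s≤m , inj₂ c) with d + s <? q
  ... | yes d+s<q =
    ≤-trans (≤-reflexive (m+n≡0⇒m≡0 d (≡ₘ0⇒≡0 d+s<q (cancel-to-0 a (subst (_≡ₘ a) (+-assoc a d s) c) refl)))) z≤n
  ... | no d+s≮q  = ≤-trans (<⇒≤ (+-cancelˡ-< d d s (<-≤-trans 2d<q (≮⇒≥ d+s≮q)))) s≤m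

  private
    module Between {s d t₁ t₂} (s≤d : s ≤ d) (2d<q : d + d < q) (t₁≤s : t₁ ≤ s) (t₂≤d∸s : t₂ ≤ d ∸ s) where

      d<q : d < q
      d<q = ≤-<-trans (m≤m+n d d) 2d<q

      t₂≤d : t₂ ≤ d
      t₂≤d = ≤-trans t₂≤d∸s (m∸n≤m d s)

      t₁+t₂≤d : t₁ + t₂ ≤ d
      t₁+t₂≤d = ≤-trans (+-mono-≤ t₁≤s t₂≤d∸s) (≤-reflexive (m+[n∸m]≡n s≤d))

      m+n≤n⇒m≡0 : ∀ {m n} → m + n ≤ n → m ≡ 0
      m+n≤n⇒m≡0 {m} {n} m+n≤n = n≤0⇒n≡0 (+-cancelʳ-≤ n m 0 m+n≤n)

      ahead : ∀ {p a} → a + t₁ ≡ₘ p → p + t₂ ≡ₘ a + d ⊎ a + d + t₂ ≡ₘ p → t₁ ≡ s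
      ahead {p} {a} c₁ (inj₁ c₂) = ≤-antisym t₁≤s (subst (_≤ t₁) (m∸[m∸n]≡n s≤d)
                             (m≤n+o⇒m∸n≤o d (d ∸ s) (subst (_≤ (d ∸ s) + t₁) t₁+t₂≡d
                               (subst (t₁ + t₂ ≤_) (+-comm t₁ (d ∸ s)) (+-monoʳ-≤ t₁ t₂≤d∸s)))))
        where
        t₁+t₂≡d : t₁ + t₂ ≡ d
        t₁+t₂≡d = ≡ₘ-small⇒≡ (≤-<-trans t₁+t₂≤d d<q) d<q
                    (≡ₘ-cancelˡ a (subst (_≡ₘ a + d) (+-assoc a t₁ t₂) (≡ₘ-trans (≡ₘ-+ʳ t₂ c₁) c₂)))
      ahead {p} {a} c₁ (inj₂ c₂) = ≤-antisym t₁≤s (≤-trans s≤d (≤-trans (m≤m+n d t₂) (≤-reflexive (sym t₁≡d+t₂))))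
        where
        t₁≡d+t₂ : t₁ ≡ d + t₂
        t₁≡d+t₂ = ≡ₘ-small⇒≡ (≤-<-trans (≤-trans t₁≤s s≤d) d<q) (≤-<-trans (+-monoʳ-≤ d t₂≤d) 2d<q)
                    (≡ₘ-cancelˡ a (subst (a + t₁ ≡ₘ_) (+-assoc a d t₂) (≡ₘ-trans c₁ (≡ₘ-sym c₂))))

      behind : ∀ {p a} → p + t₁ ≡ₘ a → p + t₂ ≡ₘ a + d ⊎ a + d + t₂ ≡ₘ p → s ≡ 0 × t₁ ≡ 0
      behind {p} {a} c₁ (inj₁ c₂) = m+n≤n⇒m≡0 (subst₂ _≤_ (+-comm d s) (m∸n+n≡m s≤d) (+-monoˡ-≤ s d≤d∸s)) ,
                            m+n≤n⇒m≡0 (≤-trans (≤-reflexive t₁+d≡t₂) t₂≤d)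
        where
        t₁+d≡t₂ : t₁ + d ≡ t₂
        t₁+d≡t₂ = ≡ₘ-small⇒≡ (≤-<-trans (+-monoˡ-≤ d (≤-trans t₁≤s s≤d)) 2d<q) (≤-<-trans t₂≤d d<q)
                    (≡ₘ-cancelˡ p (subst (_≡ₘ p + t₂) (+-assoc p t₁ d) (≡ₘ-trans (≡ₘ-+ʳ d c₁) (≡ₘ-sym c₂))))
        d≤d∸s : d ≤ d ∸ s
        d≤d∸s = ≤-trans (m≤n+m d t₁) (≤-trans (≤-reflexive t₁+d≡t₂) t₂≤d∸s)
      behind {p} {a} c₁ (inj₂ c₂) = n≤0⇒n≡0 (≤-trans s≤d (≤-reflexive (m+n≡0⇒m≡0 d (m+n≡0⇒m≡0 (d + t₂) d+t₂+t₁≡0)))) ,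
                            m+n≡0⇒n≡0 (d + t₂) d+t₂+t₁≡0
        where
        d+t₂+t₁≡0 : d + t₂ + t₁ ≡ 0
        d+t₂+t₁≡0 = ≡ₘ0⇒≡0 (≤-<-trans (≤-trans (≤-reflexive (+-assoc d t₂ t₁))
                                                 (+-monoʳ-≤ d (subst (_≤ d) (+-comm t₁ t₂) t₁+t₂≤d))) 2d<q)
                      (cancel-to-0 a (subst (_≡ₘ a) (trans (cong (_+ t₁) (+-assoc a d t₂)) (+-assoc a (d + t₂) t₁))
                                                (≡ₘ-trans (≡ₘ-+ʳ t₁ c₂) c₁)) refl)

  Close-between : ∀ {s p a d} → s ≤ d → d + d < q → Close s p a → Close (d ∸ s) p (a + d) → a + s ≡ₘ p
  Close-between {a = a} s≤d 2d<q (t₁ , t₁≤s , inj₂ c₁) (t₂ , t₂≤d∸s , c₂) =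
    subst (λ t → a + t ≡ₘ _) (Between.ahead s≤d 2d<q t₁≤s t₂≤d∸s c₁ c₂) c₁
  Close-between {p = p} {a} s≤d 2d<q (t₁ , t₁≤s , inj₁ c₁) (t₂ , t₂≤d∸s , c₂)
    with Between.behind s≤d 2d<q t₁≤s t₂≤d∸s c₁ c₂
  ... | refl , refl = subst₂ _≡ₘ_ (sym (+-identityʳ a)) (+-identityʳ p) (≡ₘ-sym c₁)

  private
    three-parts : ∀ d → d + 1 + d + (d + 1) ≡ 3 * d + 2
    three-parts = solve-∀

    offset≤1 : ∀ {a b d s} → 3 * d + 2 < q → s ≤ d + 1 → a + s ≡ₘ b → Close (d + 1) a (b + d) → s ≤ 1
    offset≤1 {a} {b} {d} {s} 3d+2<q s≤ c (s′ , s′≤ , inj₁ c′) = +-cancelʳ-≤ d s 1 (subst (s + d ≤_) (+-comm d 1) s+d≤d+1)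
      where
      d+1+d≤3d+2 : d + 1 + d ≤ 3 * d + 2
      d+1+d≤3d+2 = subst (d + 1 + d ≤_) (three-parts d) (m≤m+n (d + 1 + d) (d + 1))
      s+d≤3d+2 : s + d ≤ 3 * d + 2
      s+d≤3d+2 = ≤-trans (+-monoˡ-≤ d s≤) d+1+d≤3d+2
      s′≡s+d : s′ ≡ s + d
      s′≡s+d = ≡ₘ-small⇒≡ (≤-<-trans (≤-trans s′≤ (≤-trans (m≤m+n (d + 1) d) d+1+d≤3d+2)) 3d+2<q)
                          (≤-<-trans s+d≤3d+2 3d+2<q)
                 (≡ₘ-cancelˡ a (subst (a + s′ ≡ₘ_) (+-assoc a s d) (≡ₘ-trans c′ (≡ₘ-sym (≡ₘ-+ʳ d c)))))
      s+d≤d+1 : s + d ≤ d + 1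
      s+d≤d+1 = subst (_≤ d + 1) s′≡s+d s′≤
    offset≤1 {a} {b} {d} {s} 3d+2<q s≤ c (s′ , s′≤ , inj₂ c′) = ≤-trans (≤-reflexive s≡0) z≤n
      where
      sum≤ : s + d + s′ ≤ 3 * d + 2
      sum≤ = ≤-trans (+-mono-≤ (+-monoˡ-≤ d s≤) s′≤) (≤-reflexive (three-parts d))
      s≡0 : s ≡ 0
      s≡0 = m+n≡0⇒m≡0 s (m+n≡0⇒m≡0 (s + d) (≡ₘ0⇒≡0 (≤-<-trans sum≤ 3d+2<q)
              (cancel-to-0 a (subst (_≡ₘ a) (trans (cong (_+ s′) (+-assoc a s d)) (+-assoc a (s + d) s′))
                                        (≡ₘ-trans (≡ₘ-+ʳ s′ (≡ₘ-+ʳ d c)) c′)) refl)))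

  Close-arc-starts : ∀ {a b d} → 3 * d + 2 < q → Close (d + 1) a b → Close (d + 1) a (b + d) → Close (d + 1) (a + d) b →
                    Close 1 a b
  Close-arc-starts 3d+2<q (s , s≤ , inj₁ c) c′ _  = s , offset≤1 3d+2<q s≤ c c′ , inj₁ c
  Close-arc-starts 3d+2<q (s , s≤ , inj₂ c) _  c″ = s , offset≤1 3d+2<q s≤ c (Close-sym c″) , inj₂ c

-- Walks and vertex counts

module Walks (G : Graph) where

  V : Set
  V = Fin (order G)

  N : ℕ
  N = order G

  A : V → V → Bool
  A = Adj G

  count : (V → Bool) → ℕ
  count P = sumFin N (𝟙 ∘ P)

  deg≡count : ∀ v → deg G v ≡ count (A v)
  deg≡count v = begin
    sum (List.map (λ u → if A v u then 1 else 0) (allFin N))  ≡⟨ cong sum (map-tabulate id (λ u → if A v u then 1 else 0)) ⟩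
    sum (tabulate (λ u → if A v u then 1 else 0))            ≡⟨ sum-tabulate N _ ⟩
    sumFin N (λ u → if A v u then 1 else 0)                   ≡⟨ sumFin-cong N (λ u → if≡𝟙 (A v u)) ⟩
    count (A v)                                                ∎
    where
    open ≡-Reasoning
    sum-tabulate : ∀ m (f : Fin m → ℕ) → sum (tabulate f) ≡ sumFin m f
    sum-tabulate zero    f = refl
    sum-tabulate (suc m) f = cong (f zero +_) (sum-tabulate m (f ∘ suc))
    if≡𝟙 : ∀ b → (if b then 1 else 0) ≡ 𝟙 b
    if≡𝟙 true  = refl
    if≡𝟙 false = refl

  count-mono : ∀ {P Q : V → Bool} → (∀ x → P x ≡ true → Q x ≡ true) → count P ≤ count Q
  count-mono {P} {Q} P⊆Q = sumFin-mono N (λ x → 𝟙-mono (P x) (Q x) (P⊆Q x))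
    where
    𝟙-mono : ∀ a b → (a ≡ true → b ≡ true) → 𝟙 a ≤ 𝟙 b
    𝟙-mono false b _   = z≤n
    𝟙-mono true  b a⇒b = ≤-reflexive (cong 𝟙 (sym (a⇒b refl)))

  count-split : ∀ (P Q : V → Bool) → count P ≡ count (λ x → P x ∧ Q x) + count (λ x → P x ∧ not (Q x))
  count-split P Q = trans (sumFin-cong N (λ x → split (P x) (Q x))) (sumFin-+ N _ _)
    where
    split : ∀ a b → 𝟙 a ≡ 𝟙 (a ∧ b) + 𝟙 (a ∧ not b)
    split false b     = refl
    split true  false = refl
    split true  true  = refl

  count-∨ : ∀ (P Q : V → Bool) → (∀ x → P x ≡ true → Q x ≡ true → ⊥) → count (λ x → P x ∨ Q x) ≡ count P + count Q
  count-∨ P Q disjoint = trans (sumFin-cong N (λ x → 𝟙-∨ (P x) (Q x) (disjoint x))) (sumFin-+ N _ _)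
    where
    𝟙-∨ : ∀ a b → (a ≡ true → b ≡ true → ⊥) → 𝟙 (a ∨ b) ≡ 𝟙 a + 𝟙 b
    𝟙-∨ false b     _ = refl
    𝟙-∨ true  false _ = refl
    𝟙-∨ true  true  d = ⊥-elim (d refl refl)

  count-∧-const : ∀ b (P : V → Bool) → count (λ x → b ∧ P x) ≡ 𝟙 b * count P
  count-∧-const false P = sumFin-zero N
  count-∧-const true  P = sym (+-identityʳ _)

  count-false : ∀ (P : V → Bool) → (∀ x → P x ≡ false) → count P ≡ 0
  count-false P none = trans (sumFin-cong N (cong 𝟙 ∘ none)) (sumFin-zero N)

  count-remove : ∀ (P : V → Bool) y → count P ≡ count (λ x → P x ∧ not ⌊ x ≟ᶠ y ⌋) + 𝟙 (P y)
  count-remove P y = begin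
    count P                                ≡⟨ count-split P (λ x → ⌊ x ≟ᶠ y ⌋) ⟩
    count (λ x → P x ∧ ⌊ x ≟ᶠ y ⌋) + rest   ≡⟨ cong (_+ rest) (sumFin-single N _ y off-y) ⟩
    𝟙 (P y ∧ ⌊ y ≟ᶠ y ⌋) + rest             ≡⟨ cong (λ d → 𝟙 (P y ∧ ⌊ d ⌋) + rest) (≡-≟-identity _≟ᶠ_ refl) ⟩
    𝟙 (P y ∧ true) + rest                   ≡⟨ cong (λ b → 𝟙 b + rest) (∧-identityʳ (P y)) ⟩
    𝟙 (P y) + rest                          ≡⟨ +-comm (𝟙 (P y)) rest ⟩
    rest + 𝟙 (P y)                          ∎
    where
    open ≡-Reasoning
    rest : ℕ
    rest = count (λ x → P x ∧ not ⌊ x ≟ᶠ y ⌋)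
    off-y : ∀ x → x ≢ y → 𝟙 (P x ∧ ⌊ x ≟ᶠ y ⌋) ≡ 0
    off-y x x≢y = trans (cong (λ d → 𝟙 (P x ∧ ⌊ d ⌋)) (≢-≟-identity _≟ᶠ_ x≢y)) (cong 𝟙 (∧-zeroʳ (P x)))

  count-≤1 : ∀ (P : V → Bool) → (∀ x y → P x ≡ true → P y ≡ true → x ≡ y) → count P ≤ 1
  count-≤1 P unique with any? (λ y → P y Bool.≟ true)
  ... | yes (y , Py) = ≤-reflexive (trans (sumFin-single N (𝟙 ∘ P) y off-y) (cong 𝟙 Py))
    where
    off-y : ∀ x → x ≢ y → 𝟙 (P x) ≡ 0
    off-y x x≢y = cong 𝟙 (¬-not (λ Px → x≢y (unique x y Px Py)))
  ... | no none = ≤-trans (≤-reflexive (count-false P (λ x → ¬-not (λ Px → none (x , Px))))) z≤n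

  two≤count : ∀ (P : V → Bool) {x y} → x ≢ y → P x ≡ true → P y ≡ true → 2 ≤ count P
  two≤count P {x} {y} x≢y Px Py = subst (_≤ count P) (cong₂ _+_ (cong 𝟙 Px) (cong 𝟙 Py)) (sumFin-two-terms≤ N (𝟙 ∘ P) x≢y)

  one≤count : ∀ (P : V → Bool) {x} → P x ≡ true → 1 ≤ count P
  one≤count P {x} Px = subst (_≤ count P) (cong 𝟙 Px) (sumFin-term≤ N (𝟙 ∘ P) x)

  infixr 5 _++ʷ_

  _++ʷ_ : ∀ {x y z a b} → Walk G x y a → Walk G y z b → Walk G x z (a + b)
  here     ++ʷ w = w
  step e p ++ʷ w = step e (p ++ʷ w)

  reverseʷ : ∀ {x y a} → Walk G x y a → Walk G y x a
  reverseʷ here = here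
  reverseʷ {a = suc a} (step {x} {z} e p) =
    subst (Walk G _ _) (+-comm a 1) (reverseʷ p ++ʷ step (trans (Adj-sym G z x) e) here)

  Reach : ℕ → V → V → Set
  Reach l x y = Σ[ m ∈ ℕ ] m ≤ l × Walk G x y m

  Reach-refl : ∀ {x} → Reach 0 x x
  Reach-refl = 0 , z≤n , here

  Reach-edge : ∀ {x y} → A x y ≡ true → Reach 1 x y
  Reach-edge e = 1 , ≤-refl , step e here

  Reach-mono : ∀ {l l′ x y} → l ≤ l′ → Reach l x y → Reach l′ x y
  Reach-mono l≤l′ (m , m≤l , w) = m , ≤-trans m≤l l≤l′ , w

  Reach-trans : ∀ {a b x y z} → Reach a x y → Reach b y z → Reach (a + b) x z
  Reach-trans (m₁ , m₁≤ , w₁) (m₂ , m₂≤ , w₂) = m₁ + m₂ , +-mono-≤ m₁≤ m₂≤ , w₁ ++ʷ w₂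

  Reach-sym : ∀ {l x y} → Reach l x y → Reach l y x
  Reach-sym (m , m≤l , w) = m , m≤l , reverseʷ w

  Reach-0⇒≡ : ∀ {x y} → Reach 0 x y → x ≡ y
  Reach-0⇒≡ (zero , z≤n , here) = refl

  reach? : ℕ → V → V → Bool
  reach? zero    x y = ⌊ x ≟ᶠ y ⌋
  reach? (suc l) x y = reach? l x y ∨ ⌊ any? (λ z → A x z ∧ reach? l z y Bool.≟ true) ⌋

  reach?-sound : ∀ l {x y} → reach? l x y ≡ true → Reach l x y
  reach?-sound zero {x} {y} e with x ≟ᶠ y
  ... | yes refl = Reach-refl
  reach?-sound (suc l) {x} {y} e with reach? l x y in r | any? (λ z → A x z ∧ reach? l z y Bool.≟ true)
  ... | true  | _ = Reach-mono (n≤1+n l) (reach?-sound l r)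
  ... | false | yes (z , xzy) with reach?-sound l (proj₂ (∧-true {A x z} xzy))
  ...   | m , m≤l , w = suc m , s≤s m≤l , step (proj₁ (∧-true {A x z} xzy)) w

  reach?-complete : ∀ {l x y} → Reach l x y → reach? l x y ≡ true
  reach?-complete {zero}  (zero , _ , here) = cong ⌊_⌋ (≡-≟-identity _≟ᶠ_ refl)
  reach?-complete {suc l} (zero , _ , here) = ∨-trueˡ (reach?-complete {l} (zero , z≤n , here))
  reach?-complete {suc l} {x} {y} (suc m , s≤s m≤l , step {z = z} e w) = ∨-trueʳ found
    where
    found : ⌊ any? (λ z → A x z ∧ reach? l z y Bool.≟ true) ⌋ ≡ true
    found with any? (λ z → A x z ∧ reach? l z y Bool.≟ true)
    ... | yes _   = refl
    ... | no none = ⊥-elim (none (z , cong₂ _∧_ e (reach?-complete (m , m≤l , w))))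

  vertexAt : ∀ {x y l} → Walk G x y l → ℕ → V
  vertexAt {x} here       t       = x
  vertexAt {x} (step e w) zero    = x
  vertexAt     (step e w) (suc t) = vertexAt w t

  vertexAt-0 : ∀ {x y l} (w : Walk G x y l) → vertexAt w 0 ≡ x
  vertexAt-0 here       = refl
  vertexAt-0 (step e w) = refl

  vertexAt-end : ∀ {x y l} (w : Walk G x y l) t → l ≤ t → vertexAt w t ≡ y
  vertexAt-end here       t       _         = refl
  vertexAt-end (step e w) (suc t) (s≤s l≤t) = vertexAt-end w t l≤t

  vertexAt-adj : ∀ {x y l} (w : Walk G x y l) t → t < l → A (vertexAt w t) (vertexAt w (suc t)) ≡ true
  vertexAt-adj (step e w) zero    _         = subst (λ z → A _ z ≡ true) (sym (vertexAt-0 w)) e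
  vertexAt-adj (step e w) (suc t) (s≤s t<l) = vertexAt-adj w t t<l

  vertexAt-++ʷ : ∀ {x y z a b} (p : Walk G x y a) (w : Walk G y z b) t → t ≤ a → vertexAt (p ++ʷ w) t ≡ vertexAt p t
  vertexAt-++ʷ here       w zero    _         = vertexAt-0 w
  vertexAt-++ʷ (step e p) w zero    _         = refl
  vertexAt-++ʷ (step e p) w (suc t) (s≤s t≤a) = vertexAt-++ʷ p w t t≤a

  walkAlong : (v : ℕ → V) → ∀ i m → (∀ t → i ≤ t → t < i + m → A (v t) (v (suc t)) ≡ true) → Walk G (v i) (v (i + m)) m
  walkAlong v i zero    adj = subst (λ j → Walk G (v i) (v j) 0) (sym (+-identityʳ i)) here
  walkAlong v i (suc m) adj = step (adj i ≤-refl (m<m+n i z<s))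
    (subst (λ j → Walk G (v (suc i)) (v j) m) (sym (+-suc i m))
      (walkAlong v (suc i) m (λ t i<t t< → adj t (<⇒≤ i<t) (subst (t <_) (sym (+-suc i m)) t<))))

  Reach-along : (v : ℕ → V) → ∀ {i j L} → i ≤ j → j ≤ L → (∀ t → t < L → A (v t) (v (suc t)) ≡ true) →
                Reach (j ∸ i) (v i) (v j)
  Reach-along v {i} {j} i≤j j≤L adj = j ∸ i , ≤-refl ,
    subst (λ k → Walk G (v i) (v k) (j ∸ i)) (m+[n∸m]≡n i≤j)
      (walkAlong v i (j ∸ i) (λ t _ t< → adj t (≤-trans (≤-trans t< (≤-reflexive (m+[n∸m]≡n i≤j))) j≤L)))

  closedPath⇒cycle : (w : ℕ → V) (m : ℕ) → 3 ≤ m → (∀ t → t < m → A (w t) (w (suc t)) ≡ true) → w m ≡ w 0 →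
                     (∀ s t → s < t → t < m → w s ≢ w t) → Cycle G m
  closedPath⇒cycle w m 3≤m adj closed distinct = record
    { vert  = w ∘ toℕ
    ; inj   = injective
    ; len≥3 = 3≤m
    ; next  = λ p p′ 1+p≡p′ → subst (λ t → A (w (toℕ p)) (w t) ≡ true) 1+p≡p′ (adj (toℕ p) (toℕ<n p))
    ; close = λ p p′ p≡m-1 p′≡0 → subst₂ (λ s t → A (w s) (w t) ≡ true) (sym p≡m-1) (sym p′≡0)
                (subst (λ u → A (w (m ∸ 1)) u ≡ true) (trans (cong w m-1+1) closed) (adj (m ∸ 1) (m∸1<m)))
    }
    where
    m-1+1 : suc (m ∸ 1) ≡ m
    m-1+1 = m+[n∸m]≡n (≤-trans (s≤s z≤n) 3≤m)
    m∸1<m : m ∸ 1 < m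
    m∸1<m = ≤-reflexive m-1+1
    injective : ∀ {p p′ : Fin m} → w (toℕ p) ≡ w (toℕ p′) → p ≡ p′
    injective {p} {p′} e with <-cmp (toℕ p) (toℕ p′)
    ... | tri< p<p′ _ _ = ⊥-elim (distinct _ _ p<p′ (toℕ<n p′) e)
    ... | tri≈ _ p≡p′ _ = toℕ-injective p≡p′
    ... | tri> _ _ p′<p = ⊥-elim (distinct _ _ p′<p (toℕ<n p) (sym e))

  private
    repeats? : (v : ℕ → V) → ∀ j → Dec (Σ[ i ∈ ℕ ] i < j × v i ≡ v j)
    repeats? v j = anyUpTo? (λ i → v i ≟ᶠ v j) j

  -- From the first repetition of a vertex back to its earlier occurrence the walk is a cycle:
  -- it has no loops, and as it does not backtrack, no 2-cycles either.
  closedWalk⇒cycle : (v : ℕ → V) (L : ℕ) → 1 ≤ L → (∀ t → t < L → A (v t) (v (suc t)) ≡ true) → v L ≡ v 0 →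
                     (∀ t → suc t < L → v t ≢ v (suc (suc t))) → Σ[ m ∈ ℕ ] m ≤ L × Cycle G m
  closedWalk⇒cycle v L 1≤L adj closed no-backtrack with minimal-or-none (repeats? v) (suc L)
  ... | inj₂ none = ⊥-elim (none L ≤-refl (0 , 1≤L , sym closed))
  ... | inj₁ (j , j<1+L , (i , i<j , vi≡vj) , before) with m≤n⇒∃[o]m+o≡n (<⇒≤ i<j)
  ...   | m , refl = m , ≤-trans (m≤n+m m i) (≤-pred j<1+L) ,
                     closedPath⇒cycle (v ∘ (i +_)) m 3≤m adj′ (trans (sym vi≡vj) (cong v (sym (+-identityʳ i)))) distinct
    where
    i+m≤L : i + m ≤ L
    i+m≤L = ≤-pred j<1+L
    adj′ : ∀ t → t < m → A (v (i + t)) (v (i + suc t)) ≡ true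
    adj′ t t<m = subst (λ u → A (v (i + t)) (v u) ≡ true) (sym (+-suc i t)) (adj (i + t) (<-≤-trans (+-monoʳ-< i t<m) i+m≤L))
    distinct : ∀ s t → s < t → t < m → v (i + s) ≢ v (i + t)
    distinct s t s<t t<m e = before (i + t) (+-monoʳ-< i t<m) (i + s , +-monoʳ-< i s<t , e)
    m≢0 : m ≢ 0
    m≢0 refl = <-irrefl (sym (+-identityʳ i)) i<j
    m≢1 : m ≢ 1
    m≢1 refl = true≢false (subst₂ (λ x y → A x y ≡ true) (cong v (+-identityʳ i)) (sym vi≡vj) (adj′ 0 z<s)) (irrfl G (v i))
    m≢2 : m ≢ 2
    m≢2 refl = no-backtrack i (subst (_≤ L) (+-comm i 2) i+m≤L) (trans vi≡vj (cong v (+-comm i 2)))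
    3≤m : 3 ≤ m
    3≤m = three≤ m m≢0 m≢1 m≢2
      where
      three≤ : ∀ m → m ≢ 0 → m ≢ 1 → m ≢ 2 → 3 ≤ m
      three≤ 0 m≢0 _ _ = ⊥-elim (m≢0 refl)
      three≤ 1 _ m≢1 _ = ⊥-elim (m≢1 refl)
      three≤ 2 _ _ m≢2 = ⊥-elim (m≢2 refl)
      three≤ (suc (suc (suc m))) _ _ _ = s≤s (s≤s (s≤s z≤n))

-- Breadth-first layers in a graph of large girth

module Layers (G : Graph) (g k : ℕ) (girth : ∀ L → Cycle G L → g ≤ L) (c c′ : Fin (order G))
              (roots : c ≡ c′ ⊎ (Adj G c c′ ≡ true × 2 * k + 2 ≤ g)) (2k+1≤g : 2 * k + 1 ≤ g) where

  open Walks G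

  IsRoot : V → Set
  IsRoot r = r ≡ c ⊎ r ≡ c′

  Ball : ℕ → V → Bool
  Ball l x = reach? l c x ∨ reach? l c′ x

  Level : ℕ → V → Bool
  Level zero    x = Ball 0 x
  Level (suc j) x = Ball (suc j) x ∧ not (Ball j x)

  Ball-sound : ∀ l {x} → Ball l x ≡ true → Σ[ r ∈ V ] IsRoot r × Reach l r x
  Ball-sound l {x} e with ∨-true {reach? l c x} e
  ... | inj₁ e₁ = c  , inj₁ refl , reach?-sound l e₁
  ... | inj₂ e₂ = c′ , inj₂ refl , reach?-sound l e₂

  Ball-complete : ∀ l {r x} → IsRoot r → Reach l r x → Ball l x ≡ true
  Ball-complete l (inj₁ refl) w = ∨-trueˡ (reach?-complete w)
  Ball-complete l (inj₂ refl) w = ∨-trueʳ (reach?-complete w)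

  Ball-extend : ∀ a b {y z} → Ball a y ≡ true → Reach b y z → Ball (a + b) z ≡ true
  Ball-extend a b e w with Ball-sound a e
  ... | r , root , w₀ = Ball-complete (a + b) root (Reach-trans w₀ w)

  Ball-mono : ∀ {a b x} → a ≤ b → Ball a x ≡ true → Ball b x ≡ true
  Ball-mono {a} {b} a≤b e with Ball-sound a e
  ... | r , root , w₀ = Ball-complete b root (Reach-mono a≤b w₀)

  Ball-edge : ∀ j {v x} → Ball j v ≡ true → A v x ≡ true → Ball (suc j) x ≡ true
  Ball-edge j {x = x} v∈Ball vx = subst (λ l → Ball l x ≡ true) (+-comm j 1) (Ball-extend j 1 v∈Ball (Reach-edge vx))

  Ball0⇒IsRoot : ∀ {x} → Ball 0 x ≡ true → IsRoot x
  Ball0⇒IsRoot e with Ball-sound 0 e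
  ... | r , inj₁ r≡c  , w = inj₁ (trans (sym (Reach-0⇒≡ w)) r≡c)
  ... | r , inj₂ r≡c′ , w = inj₂ (trans (sym (Reach-0⇒≡ w)) r≡c′)

  Level⇒Ball : ∀ j {x} → Level j x ≡ true → Ball j x ≡ true
  Level⇒Ball zero        e = e
  Level⇒Ball (suc j) {x} e = proj₁ (∧-true {Ball (suc j) x} e)

  Level⇒¬Ball : ∀ j {x} → Level (suc j) x ≡ true → Ball j x ≡ false
  Level⇒¬Ball j {x} e = not-true (proj₂ (∧-true {Ball (suc j) x} e))

  Level-intro : ∀ j {x} → Ball (suc j) x ≡ true → Ball j x ≡ false → Level (suc j) x ≡ true
  Level-intro j e₁ e₂ rewrite e₁ | e₂ = refl

  IsRoot⇒Level0 : ∀ {r} → IsRoot r → Level 0 r ≡ true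
  IsRoot⇒Level0 root = Ball-complete 0 root Reach-refl

  private
    Level-below : ∀ {a b x} → a < b → Level a x ≡ true → Level b x ≡ true → ⊥
    Level-below {a} {suc b} (s≤s a≤b) ea eb = true≢false (Ball-mono a≤b (Level⇒Ball a ea)) (Level⇒¬Ball b eb)

  Level-unique : ∀ a b {x} → Level a x ≡ true → Level b x ≡ true → a ≡ b
  Level-unique a b ea eb with <-cmp a b
  ... | tri< a<b _ _ = ⊥-elim (Level-below a<b ea eb)
  ... | tri≈ _ a≡b _ = a≡b
  ... | tri> _ _ b<a = ⊥-elim (Level-below b<a eb ea)

  Level-distinct : ∀ a b {x y} → Level a x ≡ true → Level b y ≡ true → a ≢ b → x ≢ y
  Level-distinct a b ex ey a≢b refl = a≢b (Level-unique a b ex ey)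

  Level-walk-length : ∀ j {x r m} → Level j x ≡ true → IsRoot r → m ≤ j → Walk G r x m → m ≡ j
  Level-walk-length zero    _ _    z≤n _ = refl
  Level-walk-length (suc j) e root m≤j w with m≤n⇒m<n∨m≡n m≤j
  ... | inj₂ m≡j       = m≡j
  ... | inj₁ (s≤s m≤j) = ⊥-elim (true≢false (Ball-complete j root (_ , m≤j , w)) (Level⇒¬Ball j e))

  record Geodesic (j : ℕ) (x : V) : Set where
    field
      path       : ℕ → V
      path-root  : IsRoot (path 0)
      path-end   : path j ≡ x
      path-adj   : ∀ t → t < j → A (path t) (path (suc t)) ≡ true
      path-level : ∀ t → t ≤ j → Level t (path t) ≡ true

  geodesic : ∀ j {x} → Level j x ≡ true → Geodesic j x
  geodesic j {x} x∈Level with Ball-sound j (Level⇒Ball j x∈Level)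
  ... | r , root , (m , m≤j , w) = record
    { path       = p
    ; path-root  = p-root
    ; path-end   = p-end
    ; path-adj   = p-adj
    ; path-level = p-level
    }
    where
    p : ℕ → V
    p = vertexAt w
    m≡j : m ≡ j
    m≡j = Level-walk-length j x∈Level root m≤j w
    p-end : p j ≡ x
    p-end = vertexAt-end w j (≤-reflexive m≡j)
    p-adj : ∀ t → t < j → A (p t) (p (suc t)) ≡ true
    p-adj t t<j = vertexAt-adj w t (subst (t <_) (sym m≡j) t<j)
    p-root : IsRoot (p 0)
    p-root = subst IsRoot (sym (vertexAt-0 w)) root
    -- a shortcut to p (1 + t) would give a shortcut to x
    not-earlier : ∀ j t → Level j x ≡ true → p j ≡ x → (∀ s → s < j → A (p s) (p (suc s)) ≡ true) →
                  suc t ≤ j → Ball t (p (suc t)) ≡ false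
    not-earlier (suc j) t x∈Level pj≡x adj (s≤s t≤j) with Ball t (p (suc t)) in e
    ... | false = refl
    ... | true  = ⊥-elim (true≢false (subst (λ l → Ball l x ≡ true) (m+[n∸m]≡n t≤j) (Ball-extend t (j ∸ t) e rest))
                                     (Level⇒¬Ball j x∈Level))
      where
      rest : Reach (j ∸ t) (p (suc t)) x
      rest = subst (Reach (j ∸ t) (p (suc t))) pj≡x (Reach-along p (s≤s t≤j) ≤-refl adj)
    p-level : ∀ t → t ≤ j → Level t (p t) ≡ true
    p-level zero    _   = IsRoot⇒Level0 p-root
    p-level (suc t) t<j = Level-intro t (Ball-complete (suc t) p-root (Reach-along p z≤n t<j p-adj))
                                        (not-earlier j t x∈Level p-end p-adj t<j)

  Geodesic-extend : ∀ {j v x} → Geodesic j v → A v x ≡ true → Level (suc j) x ≡ true →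
                    Σ[ P ∈ Geodesic (suc j) x ] Geodesic.path P j ≡ v
  Geodesic-extend {j} {v} {x} P vx x∈Level = record
    { path       = p′
    ; path-root  = subst IsRoot (sym (p′≡p 0 z≤n)) (path-root P)
    ; path-end   = p′-end
    ; path-adj   = p′-adj
    ; path-level = p′-level
    } , trans (p′≡p j ≤-refl) (path-end P)
    where
    open Geodesic
    p′ : ℕ → V
    p′ t with t ≤? j
    ... | yes _ = path P t
    ... | no _  = x
    p′≡p : ∀ t → t ≤ j → p′ t ≡ path P t
    p′≡p t t≤j with t ≤? j
    ... | yes _   = refl
    ... | no t≰j  = ⊥-elim (t≰j t≤j)
    p′-end : p′ (suc j) ≡ x
    p′-end with suc j ≤? j
    ... | yes 1+j≤j = ⊥-elim (<-irrefl refl 1+j≤j)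
    ... | no _      = refl
    p′-adj : ∀ t → t < suc j → A (p′ t) (p′ (suc t)) ≡ true
    p′-adj t t<1+j with m≤n⇒m<n∨m≡n (≤-pred t<1+j)
    ... | inj₁ t<j  = subst₂ (λ u w → A u w ≡ true) (sym (p′≡p t (<⇒≤ t<j))) (sym (p′≡p (suc t) t<j)) (path-adj P t t<j)
    ... | inj₂ refl = subst₂ (λ u w → A u w ≡ true) (sym (trans (p′≡p t ≤-refl) (path-end P))) (sym p′-end) vx
    p′-level : ∀ t → t ≤ suc j → Level t (p′ t) ≡ true
    p′-level t t≤1+j with m≤n⇒m<n∨m≡n t≤1+j
    ... | inj₁ t<1+j = subst (λ u → Level t u ≡ true) (sym (p′≡p t (≤-pred t<1+j))) (path-level P t (≤-pred t<1+j))
    ... | inj₂ refl  = subst (λ u → Level (suc j) u ≡ true) (sym p′-end) x∈Level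

  distinct-roots : ∀ {r r′} → IsRoot r → IsRoot r′ → r ≢ r′ → A r r′ ≡ true × 2 * k + 2 ≤ g
  distinct-roots {r} {r′} r-root r′-root r≢r′ = by-cases roots
    where
    by-cases : c ≡ c′ ⊎ (Adj G c c′ ≡ true × 2 * k + 2 ≤ g) → A r r′ ≡ true × 2 * k + 2 ≤ g
    by-cases (inj₁ c≡c′) = ⊥-elim (r≢r′ (trans (to-c r-root) (sym (to-c r′-root))))
      where
      to-c : ∀ {r} → IsRoot r → r ≡ c
      to-c (inj₁ e) = e
      to-c (inj₂ e) = trans e (sym c≡c′)
    by-cases (inj₂ (cc′ , 2k+2≤g)) = edge r-root r′-root , 2k+2≤g
      where
      edge : IsRoot r → IsRoot r′ → A r r′ ≡ true
      edge (inj₁ refl) (inj₁ refl) = ⊥-elim (r≢r′ refl)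
      edge (inj₁ refl) (inj₂ refl) = cc′
      edge (inj₂ refl) (inj₁ refl) = trans (Adj-sym G c′ c) cc′
      edge (inj₂ refl) (inj₂ refl) = ⊥-elim (r≢r′ refl)

  cycle-shorter-than-girth : ∀ {m n} → Cycle G m → m ≤ n → n < g → ⊥
  cycle-shorter-than-girth {m} C m≤n n<g = <⇒≱ n<g (≤-trans (girth m C) m≤n)

  -- Two geodesics whose ends are joined by an edge, followed back to the roots, form a closed walk
  -- of length at most 2k + 1 (2k + 2 if the roots differ) which does not backtrack; it would
  -- contain a cycle shorter than the girth.
  module _ {a b y z} (P : Geodesic a y) (Q : Geodesic b z) (yz : A y z ≡ true) (1≤a : 1 ≤ a)
           (turn-y : Geodesic.path P (a ∸ 1) ≢ z) (turn-z : 1 ≤ b → y ≢ Geodesic.path Q (b ∸ 1))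
           (short : a + b + 1 ≤ 2 * k) where

    private
      open Geodesic P renaming (path to p; path-root to p-root; path-end to p-end; path-adj to p-adj; path-level to p-level)
      open Geodesic Q renaming (path to q; path-root to q-root; path-end to q-end; path-adj to q-adj; path-level to q-level)

      L₀ : ℕ
      L₀ = suc (a + b)

      w : ℕ → V
      w t with t ≤? a
      ... | yes _ = p t
      ... | no _ with t ≤? L₀
      ...   | yes _ = q (L₀ ∸ t)
      ...   | no _  = p 0

      w-p : ∀ t → t ≤ a → w t ≡ p t
      w-p t t≤a with t ≤? a
      ... | yes _   = refl
      ... | no t≰a  = ⊥-elim (t≰a t≤a)

      w-q : ∀ t → a < t → t ≤ L₀ → w t ≡ q (L₀ ∸ t)
      w-q t a<t t≤L₀ with t ≤? a
      ... | yes t≤a = ⊥-elim (<⇒≱ a<t t≤a)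
      ... | no _ with t ≤? L₀
      ...   | yes _    = refl
      ...   | no t≰L₀  = ⊥-elim (t≰L₀ t≤L₀)

      w-back : w (suc L₀) ≡ p 0
      w-back with suc L₀ ≤? a
      ... | yes L₀<a = ⊥-elim (<⇒≱ L₀<a (≤-trans (m≤m+n a b) (n≤1+n _)))
      ... | no _ with suc L₀ ≤? L₀
      ...   | yes L₀<L₀ = ⊥-elim (<-irrefl refl L₀<L₀)
      ...   | no _      = refl

      L₀∸[1+a]≡b : L₀ ∸ suc a ≡ b
      L₀∸[1+a]≡b = m+n∸m≡n a b

      w-level-p : ∀ t → t ≤ a → Level t (w t) ≡ true
      w-level-p t t≤a = subst (λ x → Level t x ≡ true) (sym (w-p t t≤a)) (p-level t t≤a)

      w-level-q : ∀ t → a < t → t ≤ L₀ → Level (L₀ ∸ t) (w t) ≡ true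
      w-level-q t a<t t≤L₀ = subst (λ x → Level (L₀ ∸ t) x ≡ true) (sym (w-q t a<t t≤L₀))
                                   (q-level (L₀ ∸ t) (subst (L₀ ∸ t ≤_) L₀∸[1+a]≡b (∸-monoʳ-≤ L₀ a<t)))

      w-adj : ∀ t → t < L₀ → A (w t) (w (suc t)) ≡ true
      w-adj t t<L₀ with <-cmp t a
      ... | tri< t<a _ _ = subst₂ (λ u v → A u v ≡ true) (sym (w-p t (<⇒≤ t<a))) (sym (w-p (suc t) t<a)) (p-adj t t<a)
      ... | tri≈ _ refl _ = subst₂ (λ u v → A u v ≡ true) (sym (trans (w-p a ≤-refl) p-end))
                              (sym (trans (w-q (suc a) ≤-refl t<L₀) (trans (cong q L₀∸[1+a]≡b) q-end))) yz
      ... | tri> _ _ a<t = subst₂ (λ u v → A u v ≡ true)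
                             (sym (trans (w-q t a<t (<⇒≤ t<L₀)) (cong q (+-∸-assoc 1 t<L₀))))
                             (sym (w-q (suc t) (m<n⇒m<1+n a<t) t<L₀))
                             (trans (Adj-sym G _ _) (q-adj (L₀ ∸ suc t) (subst (_≤ b) (+-∸-assoc 1 t<L₀)
                                                                           (subst (L₀ ∸ t ≤_) L₀∸[1+a]≡b (∸-monoʳ-≤ L₀ a<t)))))

      w-no-backtrack : ∀ t → suc (suc t) ≤ L₀ → w t ≢ w (suc (suc t))
      w-no-backtrack t t+2≤L₀ with <-cmp (suc t) a
      ... | tri< 1+t<a _ _ = Level-distinct t (suc (suc t)) (w-level-p t (≤-trans (n≤1+n t) (≤-trans (n≤1+n (suc t)) 1+t<a)))
                               (w-level-p (suc (suc t)) 1+t<a) (λ t≡2+t → <-irrefl t≡2+t (m<n⇒m<1+n ≤-refl))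
      ... | tri≈ _ refl _  = λ e → turn-y (trans (sym (w-p t (n≤1+n t)))
                               (trans e (trans (w-q (suc (suc t)) ≤-refl t+2≤L₀) (trans (cong q L₀∸[1+a]≡b) q-end))))
      ... | tri> _ _ a<1+t with <-cmp t a
      ...   | tri< t<a _ _ = ⊥-elim (<⇒≱ a<1+t t<a)
      ...   | tri≈ _ refl _ = λ e → turn-z 1≤b (trans (sym p-end) (trans (sym (w-p t ≤-refl))
                                     (trans e (trans (w-q (suc (suc t)) (s≤s (n≤1+n t)) t+2≤L₀) (cong q L₀∸[2+a]≡b-1)))))
        where
        1≤b : 1 ≤ b
        1≤b = +-cancelˡ-≤ t 1 b (subst (_≤ t + b) (+-comm 1 t) (≤-pred t+2≤L₀))
        L₀∸[2+a]≡b-1 : L₀ ∸ suc (suc t) ≡ b ∸ 1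
        L₀∸[2+a]≡b-1 = trans (cong (t + b ∸_) (+-comm 1 t)) (trans (sym (∸-+-assoc (t + b) t 1)) (cong (_∸ 1) (m+n∸m≡n t b)))
      ...   | tri> _ _ a<t = Level-distinct (L₀ ∸ t) (L₀ ∸ suc (suc t))
                               (w-level-q t a<t (≤-trans (n≤1+n t) (≤-trans (n≤1+n _) t+2≤L₀)))
                               (w-level-q (suc (suc t)) (m<n⇒m<1+n (m<n⇒m<1+n a<t)) t+2≤L₀) two-apart
        where
        two-apart : L₀ ∸ t ≢ L₀ ∸ suc (suc t)
        two-apart e = <-irrefl (sym e) (subst (L₀ ∸ suc (suc t) <_)
                        (sym (trans (+-∸-assoc 1 (≤-trans (n≤1+n _) t+2≤L₀)) (cong suc (+-∸-assoc 1 t+2≤L₀))))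
                        (m<n⇒m<1+n ≤-refl))

      w-no-backtrack-back : w (a + b) ≢ w (suc L₀)
      w-no-backtrack-back e with m≤n⇒m<n∨m≡n (m≤m+n a b)
      ... | inj₁ a<a+b = Level-distinct (L₀ ∸ (a + b)) 0 (w-level-q (a + b) a<a+b (n≤1+n _))
                           (subst (λ x → Level 0 x ≡ true) (sym w-back) (IsRoot⇒Level0 p-root))
                           (λ h → 1≢0 (trans (sym (m+n∸n≡m 1 (a + b))) h)) e
        where
        1≢0 : 1 ≢ 0
        1≢0 ()
      ... | inj₂ a≡a+b = Level-distinct (a + b) 0 (w-level-p (a + b) (≤-reflexive (sym a≡a+b)))
                           (subst (λ x → Level 0 x ≡ true) (sym w-back) (IsRoot⇒Level0 p-root))
                           (λ h → <-irrefl (sym h) (≤-trans 1≤a (m≤m+n a b))) e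

      w-closed-same-root : p 0 ≡ q 0 → w L₀ ≡ w 0
      w-closed-same-root p0≡q0 = trans (w-q L₀ (s≤s (m≤m+n a b)) ≤-refl)
                                 (trans (cong q (n∸n≡0 L₀)) (sym (trans (w-p 0 z≤n) p0≡q0)))

      extend-by-root-edge : A (q 0) (p 0) ≡ true → ∀ t → t < suc L₀ → A (w t) (w (suc t)) ≡ true
      extend-by-root-edge qp t t<1+L₀ with m≤n⇒m<n∨m≡n (≤-pred t<1+L₀)
      ... | inj₁ t<L₀ = w-adj t t<L₀
      ... | inj₂ refl = subst₂ (λ u v → A u v ≡ true)
                          (sym (trans (w-q L₀ (s≤s (m≤m+n a b)) ≤-refl) (cong q (n∸n≡0 L₀)))) (sym w-back) qp

      no-backtrack-with-root-edge : ∀ t → suc t < suc L₀ → w t ≢ w (suc (suc t))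
      no-backtrack-with-root-edge t 2+t≤1+L₀ with m≤n⇒m<n∨m≡n (≤-pred 2+t≤1+L₀)
      ... | inj₁ 1+t<L₀ = w-no-backtrack t 1+t<L₀
      ... | inj₂ 1+t≡L₀ = subst (λ x → w x ≢ w (suc (suc x))) (sym (suc-injective 1+t≡L₀)) w-no-backtrack-back

      2k<g : 2 * k < g
      2k<g = subst (_≤ g) (+-comm (2 * k) 1) 2k+1≤g

      1+a+b≤2k : suc (a + b) ≤ 2 * k
      1+a+b≤2k = subst (_≤ 2 * k) (+-comm (a + b) 1) short

      2+a+b≤2k+1 : suc (suc (a + b)) ≤ 2 * k + 1
      2+a+b≤2k+1 = subst (_≤ 2 * k + 1) (trans (+-comm (a + b + 1) 1) (cong suc (+-comm (a + b) 1))) (+-monoˡ-≤ 1 short)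

    joined-geodesics⇒⊥ : ⊥
    joined-geodesics⇒⊥ with p 0 ≟ᶠ q 0
    ... | yes p0≡q0 with closedWalk⇒cycle w L₀ (s≤s z≤n) w-adj (w-closed-same-root p0≡q0) w-no-backtrack
    ...   | m , m≤L₀ , C = cycle-shorter-than-girth C (≤-trans m≤L₀ 1+a+b≤2k) 2k<g
    joined-geodesics⇒⊥ | no p0≢q0 with distinct-roots q-root p-root (p0≢q0 ∘ sym)
    ... | qp , 2k+2≤g with closedWalk⇒cycle w (suc L₀) (s≤s z≤n) (extend-by-root-edge qp) (trans w-back (sym (w-p 0 z≤n)))
                            no-backtrack-with-root-edge
    ...   | m , m≤2+a+b , C = cycle-shorter-than-girth C (≤-trans m≤2+a+b 2+a+b≤2k+1) (subst (_≤ g) (+-suc (2 * k) 1) 2k+2≤g)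

  private
    double≤2k : ∀ {j} → j + 1 ≤ k → j + 1 + (j + 1) ≤ 2 * k
    double≤2k {j} j+1≤k = subst (j + 1 + (j + 1) ≤_) (cong (k +_) (sym (+-identityʳ k))) (+-mono-≤ j+1≤k j+1≤k)

    j∸1<j : ∀ {j} → 1 ≤ j → j ∸ 1 < j
    j∸1<j (s≤s z≤n) = ≤-refl

  unique-parent : ∀ j {x v v′} → j + 1 ≤ k → Level (suc j) x ≡ true → Level j v ≡ true → Level j v′ ≡ true →
                  A v x ≡ true → A v′ x ≡ true → v ≡ v′
  unique-parent j {x} {v} {v′} j+1≤k x∈L v∈L v′∈L vx v′x with v ≟ᶠ v′
  ... | yes v≡v′ = v≡v′
  ... | no v≢v′  = ⊥-elim (joined-geodesics⇒⊥ (proj₁ P) Q (trans (Adj-sym G x v′) v′x) (s≤s z≤n) turn-y turn-z short)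
    where
    P : Σ[ P ∈ Geodesic (suc j) x ] Geodesic.path P j ≡ v
    P = Geodesic-extend (geodesic j v∈L) vx x∈L
    Q : Geodesic j v′
    Q = geodesic j v′∈L
    turn-y : Geodesic.path (proj₁ P) j ≢ v′
    turn-y e = v≢v′ (trans (sym (proj₂ P)) e)
    turn-z : 1 ≤ j → x ≢ Geodesic.path Q (j ∸ 1)
    turn-z _ = Level-distinct (suc j) (j ∸ 1) x∈L (Geodesic.path-level Q (j ∸ 1) (m∸n≤m j 1))
                              (λ e → <-irrefl (sym e) (s≤s (m∸n≤m j 1)))
    short : suc j + j + 1 ≤ 2 * k
    short = subst (_≤ 2 * k) rearrange (double≤2k j+1≤k)
      where
      rearrange : j + 1 + (j + 1) ≡ suc j + j + 1
      rearrange = solve (j ∷ [])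

  no-edge-within-level : ∀ j {v u} → 1 ≤ j → j + 1 ≤ k → Level j v ≡ true → Level j u ≡ true → A v u ≡ true → ⊥
  no-edge-within-level j {v} {u} 1≤j j+1≤k v∈L u∈L vu = joined-geodesics⇒⊥ P Q vu 1≤j turn-y turn-z short
    where
    P : Geodesic j v
    P = geodesic j v∈L
    Q : Geodesic j u
    Q = geodesic j u∈L
    turn-y : Geodesic.path P (j ∸ 1) ≢ u
    turn-y = Level-distinct (j ∸ 1) j (Geodesic.path-level P (j ∸ 1) (m∸n≤m j 1)) u∈L (λ e → <-irrefl e (j∸1<j 1≤j))
    turn-z : 1 ≤ j → v ≢ Geodesic.path Q (j ∸ 1)
    turn-z _ = Level-distinct j (j ∸ 1) v∈L (Geodesic.path-level Q (j ∸ 1) (m∸n≤m j 1)) (λ e → <-irrefl (sym e) (j∸1<j 1≤j))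
    short : j + j + 1 ≤ 2 * k
    short = ≤-trans (≤-trans (n≤1+n _) (≤-reflexive rearrange)) (double≤2k j+1≤k)
      where
      rearrange : suc (j + j + 1) ≡ j + 1 + (j + 1)
      rearrange = solve (j ∷ [])

module LayerSizes (G : Graph) (g k δ : ℕ) (girth : ∀ L → Cycle G L → g ≤ L) (c c′ : Fin (order G))
                  (roots : c ≡ c′ ⊎ (Adj G c c′ ≡ true × 2 * k + 2 ≤ g)) (2k+1≤g : 2 * k + 1 ≤ g)
                  (1≤k : 1 ≤ k) (min-deg : ∀ v → δ ≤ deg G v) where

  open Walks G
  open Layers G g k girth c c′ roots 2k+1≤g

  levelSize : ℕ → ℕ
  levelSize j = count (Level j)

  children : V → ℕ → ℕ
  children v j = count (λ x → A v x ∧ Level (suc j) x)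

  children-total≤ : ∀ j → j + 1 ≤ k → sumFin N (λ v → 𝟙 (Level j v) * children v j) ≤ levelSize (suc j)
  children-total≤ j j+1≤k = begin
    sumFin N (λ v → 𝟙 (Level j v) * children v j)
      ≡⟨ sumFin-cong N (λ v → sym (count-∧-const (Level j v) _)) ⟩
    sumFin N (λ v → sumFin N (λ x → 𝟙 (Level j v ∧ (A v x ∧ Level (suc j) x)))) ≡⟨ sumFin-swap N N _ ⟩
    sumFin N (λ x → count (λ v → Level j v ∧ (A v x ∧ Level (suc j) x)))       ≤⟨ sumFin-mono N at-most-one-parent ⟩
    levelSize (suc j)                                                           ∎
    where
    open ≤-Reasoning
    at-most-one-parent : ∀ x → count (λ v → Level j v ∧ (A v x ∧ Level (suc j) x)) ≤ 𝟙 (Level (suc j) x)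
    at-most-one-parent x with Level (suc j) x in x∈L
    ... | false = ≤-reflexive (count-false _ (λ v → trans (cong (Level j v ∧_) (∧-zeroʳ (A v x))) (∧-zeroʳ (Level j v))))
    ... | true  = count-≤1 _ (λ v v′ pv pv′ → unique-parent j j+1≤k x∈L (proj₁ (∧-true pv)) (proj₁ (∧-true pv′))
                                                (parent-edge v pv) (parent-edge v′ pv′))
      where
      parent-edge : ∀ v → Level j v ∧ (A v x ∧ true) ≡ true → A v x ≡ true
      parent-edge v pv = proj₁ (∧-true (proj₂ (∧-true {Level j v} pv)))

  neighbour-below : ∀ j {v x} → 1 ≤ j → j + 1 ≤ k → Level j v ≡ true → A v x ≡ true → Level (suc j) x ≡ false →
                    Level (j ∸ 1) x ≡ true
  neighbour-below (suc j) {v} {x} _ j+2≤k v∈L vx x∉L = at-level j x∈Ball-j v∈L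
    where
    x∈Ball-1+j : Ball (suc j) x ≡ true
    x∈Ball-1+j with true-or-false (Ball (suc j) x)
    ... | inj₁ e = e
    ... | inj₂ e = ⊥-elim (true≢false (Level-intro (suc j) (Ball-edge (suc j) (Level⇒Ball (suc j) v∈L) vx) e) x∉L)
    x∈Ball-j : Ball j x ≡ true
    x∈Ball-j with true-or-false (Ball j x)
    ... | inj₁ e = e
    ... | inj₂ e = ⊥-elim (no-edge-within-level (suc j) (s≤s z≤n) j+2≤k v∈L (Level-intro j x∈Ball-1+j e) vx)
    -- were x any closer to the roots, so would be its neighbour v
    at-level : ∀ i → Ball i x ≡ true → Level (suc i) v ≡ true → Level i x ≡ true
    at-level zero    x∈Ball _   = x∈Ball
    at-level (suc i) x∈Ball v∈L′ with true-or-false (Ball i x)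
    ... | inj₂ e = Level-intro i x∈Ball e
    ... | inj₁ e = ⊥-elim (true≢false (Ball-edge i e (trans (Adj-sym G x v) vx)) (Level⇒¬Ball (suc i) v∈L′))

  deg≤children+1 : ∀ j → 1 ≤ j → j + 1 ≤ k → ∀ v → Level j v ≡ true → deg G v ≤ children v j + 1
  deg≤children+1 j 1≤j j+1≤k v v∈L = begin
    deg G v                                                      ≡⟨ deg≡count v ⟩
    count (A v)                                                  ≡⟨ count-split (A v) (Level (suc j)) ⟩
    children v j + count (λ x → A v x ∧ not (Level (suc j) x))   ≤⟨ +-monoʳ-≤ (children v j) (count-≤1 _ unique) ⟩
    children v j + 1                                             ∎
    where
    open ≤-Reasoning
    v∈L′ : Level (suc (j ∸ 1)) v ≡ true
    v∈L′ = subst (λ i → Level i v ≡ true) (sym (m+[n∸m]≡n 1≤j)) v∈L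
    parent : ∀ x → A v x ∧ not (Level (suc j) x) ≡ true → Level (j ∸ 1) x ≡ true × A x v ≡ true
    parent x p = neighbour-below j 1≤j j+1≤k v∈L (proj₁ (∧-true p)) (not-true (proj₂ (∧-true {A v x} p))) ,
                 trans (Adj-sym G x v) (proj₁ (∧-true p))
    unique : ∀ x y → A v x ∧ not (Level (suc j) x) ≡ true → A v y ∧ not (Level (suc j) y) ≡ true → x ≡ y
    unique x y px py = unique-parent (j ∸ 1) (≤-trans (+-monoˡ-≤ 1 (m∸n≤m j 1)) j+1≤k) v∈L′
                         (proj₁ (parent x px)) (proj₁ (parent y py)) (proj₂ (parent x px)) (proj₂ (parent y py))

  levelSize-growth : ∀ j → 1 ≤ j → j + 1 ≤ k → levelSize j * (δ ∸ 1) ≤ levelSize (suc j)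
  levelSize-growth j 1≤j j+1≤k = begin
    levelSize j * (δ ∸ 1)                                ≡⟨ sumFin-*ʳ N (𝟙 ∘ Level j) (δ ∸ 1) ⟨
    sumFin N (λ v → 𝟙 (Level j v) * (δ ∸ 1))             ≤⟨ sumFin-mono N δ-1≤children ⟩
    sumFin N (λ v → 𝟙 (Level j v) * children v j)        ≤⟨ children-total≤ j j+1≤k ⟩
    levelSize (suc j)                                    ∎
    where
    open ≤-Reasoning
    δ-1≤children : ∀ v → 𝟙 (Level j v) * (δ ∸ 1) ≤ 𝟙 (Level j v) * children v j
    δ-1≤children v with Level j v in v∈L
    ... | false = z≤n
    ... | true  = +-monoˡ-≤ 0 (≤-trans (∸-monoˡ-≤ 1 (min-deg v))
                    (subst (deg G v ∸ 1 ≤_) (m+n∸n≡m (children v j) 1) (∸-monoˡ-≤ 1 (deg≤children+1 j 1≤j j+1≤k v v∈L))))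

  Ball-size-suc : ∀ j → count (Ball (suc j)) ≡ count (Ball j) + levelSize (suc j)
  Ball-size-suc j = trans (count-split (Ball (suc j)) (Ball j)) (cong (_+ levelSize (suc j)) (sumFin-cong N (cong 𝟙 ∘ inner)))
    where
    inner : ∀ x → Ball (suc j) x ∧ Ball j x ≡ Ball j x
    inner x with Ball j x in x∈B
    ... | true  = trans (∧-identityʳ (Ball (suc j) x)) (Ball-mono (n≤1+n j) x∈B)
    ... | false = ∧-zeroʳ (Ball (suc j) x)

  levelSize-lower : ∀ j → j < k → levelSize 1 * (δ ∸ 1) ^ j ≤ levelSize (suc j)
  levelSize-lower zero    _     = ≤-reflexive (*-identityʳ _)
  levelSize-lower (suc j) 1+j<k = begin
    levelSize 1 * ((δ ∸ 1) * (δ ∸ 1) ^ j)    ≡⟨ cong (levelSize 1 *_) (*-comm (δ ∸ 1) _) ⟩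
    levelSize 1 * ((δ ∸ 1) ^ j * (δ ∸ 1))    ≡⟨ *-assoc (levelSize 1) _ _ ⟨
    levelSize 1 * (δ ∸ 1) ^ j * (δ ∸ 1)      ≤⟨ *-monoˡ-≤ (δ ∸ 1) (levelSize-lower j (<-trans (n<1+n j) 1+j<k)) ⟩
    levelSize (suc j) * (δ ∸ 1)              ≤⟨ levelSize-growth (suc j) (s≤s z≤n) (subst (_≤ k) (+-comm 1 (suc j)) 1+j<k) ⟩
    levelSize (suc (suc j))                  ∎
    where open ≤-Reasoning

  Ball-size-lower : ∀ j → j < k → count (Ball 0) + levelSize 1 * powerSum (δ ∸ 1) (suc j) ≤ count (Ball (suc j))
  Ball-size-lower zero    _     = ≤-reflexive (trans (cong (count (Ball 0) +_) (*-identityʳ (levelSize 1))) (sym (Ball-size-suc 0)))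
  Ball-size-lower (suc j) 1+j<k = begin
    count (Ball 0) + levelSize 1 * powerSum (δ ∸ 1) (suc (suc j))
      ≡⟨ cong (λ s → count (Ball 0) + levelSize 1 * s) (sumℕ-snoc (suc j) ((δ ∸ 1) ^_)) ⟩
    count (Ball 0) + levelSize 1 * (powerSum (δ ∸ 1) (suc j) + (δ ∸ 1) ^ suc j)
      ≡⟨ cong (count (Ball 0) +_) (*-distribˡ-+ (levelSize 1) _ _) ⟩
    count (Ball 0) + (levelSize 1 * powerSum (δ ∸ 1) (suc j) + levelSize 1 * (δ ∸ 1) ^ suc j)
      ≡⟨ +-assoc (count (Ball 0)) _ _ ⟨
    count (Ball 0) + levelSize 1 * powerSum (δ ∸ 1) (suc j) + levelSize 1 * (δ ∸ 1) ^ suc j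
      ≤⟨ +-mono-≤ (Ball-size-lower j (<-trans (n<1+n j) 1+j<k)) (levelSize-lower (suc j) 1+j<k) ⟩
    count (Ball (suc j)) + levelSize (suc (suc j))
      ≡⟨ Ball-size-suc (suc j) ⟨
    count (Ball (suc (suc j)))
      ∎
    where open ≤-Reasoning

  Ball-k-size : count (Ball 0) + levelSize 1 * powerSum (δ ∸ 1) k ≤ count (Ball k)
  Ball-k-size = subst (λ i → count (Ball 0) + levelSize 1 * powerSum (δ ∸ 1) i ≤ count (Ball i)) (m+[n∸m]≡n 1≤k)
                      (Ball-size-lower (k ∸ 1) (≤-reflexive (m+[n∸m]≡n 1≤k)))

  private
    irreflexive : ∀ {x y} → A x y ≡ true → x ≢ y
    irreflexive {x} xy refl = true≢false xy (irrfl G x)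

    not≟⇒≢ : ∀ {x y : V} → not ⌊ x ≟ᶠ y ⌋ ≡ true → x ≢ y
    not≟⇒≢ {x} e refl = true≢false (cong ⌊_⌋ (≡-≟-identity _≟ᶠ_ refl)) (not-true e)

  root-neighbour : ∀ {r x} → IsRoot r → A r x ≡ true → x ≢ c → x ≢ c′ → Level 1 x ≡ true
  root-neighbour {r} {x} root rx x≢c x≢c′ = Level-intro 0 (Ball-edge 0 (IsRoot⇒Level0 root) rx) x∉Ball0
    where
    x∉Ball0 : Ball 0 x ≡ false
    x∉Ball0 with true-or-false (Ball 0 x)
    ... | inj₂ e = e
    ... | inj₁ e with Ball0⇒IsRoot e
    ...   | inj₁ x≡c  = ⊥-elim (x≢c x≡c)
    ...   | inj₂ x≡c′ = ⊥-elim (x≢c′ x≡c′)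

  deg≤levelSize1 : c ≡ c′ → deg G c ≤ levelSize 1
  deg≤levelSize1 c≡c′ = subst (_≤ levelSize 1) (sym (deg≡count c)) (count-mono neighbour)
    where
    neighbour : ∀ x → A c x ≡ true → Level 1 x ≡ true
    neighbour x cx = root-neighbour (inj₁ refl) cx (irreflexive cx ∘ sym)
                                    (λ x≡c′ → irreflexive cx (sym (trans x≡c′ (sym c≡c′))))

  degs≤levelSize1 : c ≢ c′ → A c c′ ≡ true → (deg G c ∸ 1) + (deg G c′ ∸ 1) ≤ levelSize 1
  degs≤levelSize1 c≢c′ cc′ = begin
    (deg G c ∸ 1) + (deg G c′ ∸ 1)     ≡⟨ cong₂ _+_ (other-neighbours c c′ cc′)
                                                    (other-neighbours c′ c (trans (Adj-sym G c′ c) cc′)) ⟩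
    count P + count P′                  ≡⟨ count-∨ P P′ disjoint ⟨
    count (λ x → P x ∨ P′ x)            ≤⟨ count-mono in-level-1 ⟩
    levelSize 1                         ∎
    where
    open ≤-Reasoning
    P P′ : V → Bool
    P  x = A c x ∧ not ⌊ x ≟ᶠ c′ ⌋
    P′ x = A c′ x ∧ not ⌊ x ≟ᶠ c ⌋
    other-neighbours : ∀ u u′ → A u u′ ≡ true → deg G u ∸ 1 ≡ count (λ x → A u x ∧ not ⌊ x ≟ᶠ u′ ⌋)
    other-neighbours u u′ uu′ = trans (cong (_∸ 1) (trans (deg≡count u) (trans (count-remove (A u) u′)
                                  (cong (λ b → count (λ x → A u x ∧ not ⌊ x ≟ᶠ u′ ⌋) + 𝟙 b) uu′)))) (m+n∸n≡m _ 1)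
    P⇒Level1 : ∀ x → P x ≡ true → Level 1 x ≡ true
    P⇒Level1 x p = root-neighbour (inj₁ refl) (proj₁ (∧-true p)) (irreflexive (proj₁ (∧-true p)) ∘ sym)
                                  (not≟⇒≢ (proj₂ (∧-true {A c x} p)))
    P′⇒Level1 : ∀ x → P′ x ≡ true → Level 1 x ≡ true
    P′⇒Level1 x p = root-neighbour (inj₂ refl) (proj₁ (∧-true p)) (not≟⇒≢ (proj₂ (∧-true {A c′ x} p)))
                                   (irreflexive (proj₁ (∧-true p)) ∘ sym)
    -- a common neighbour of c and c′ would be a vertex of level 1 with two parents
    disjoint : ∀ x → P x ≡ true → P′ x ≡ true → ⊥
    disjoint x p p′ = c≢c′ (unique-parent 0 1≤k (P⇒Level1 x p) (IsRoot⇒Level0 (inj₁ refl)) (IsRoot⇒Level0 (inj₂ refl))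
                                          (proj₁ (∧-true p)) (proj₁ (∧-true p′)))
    in-level-1 : ∀ x → P x ∨ P′ x ≡ true → Level 1 x ≡ true
    in-level-1 x e with ∨-true {P x} e
    ... | inj₁ p  = P⇒Level1 x p
    ... | inj₂ p′ = P′⇒Level1 x p′

  Ball-size-vertex : c ≡ c′ → 1 + deg G c * powerSum (δ ∸ 1) k ≤ count (Ball k)
  Ball-size-vertex c≡c′ =
    ≤-trans (+-mono-≤ (one≤count (Ball 0) (IsRoot⇒Level0 (inj₁ refl))) (*-monoˡ-≤ _ (deg≤levelSize1 c≡c′))) Ball-k-size

  Ball-size-edge : c ≢ c′ → A c c′ ≡ true → 2 + ((deg G c ∸ 1) + (deg G c′ ∸ 1)) * powerSum (δ ∸ 1) k ≤ count (Ball k)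
  Ball-size-edge c≢c′ cc′ =
    ≤-trans (+-mono-≤ (two≤count (Ball 0) c≢c′ (IsRoot⇒Level0 (inj₁ refl)) (IsRoot⇒Level0 (inj₂ refl)))
                      (*-monoˡ-≤ _ (degs≤levelSize1 c≢c′ cc′)))
            Ball-k-size

-- The Moore bound for balls around a vertex (σ = 0) or an edge (σ = 1)

IsCentre : (G : Graph) → ℕ → Fin (order G) → Fin (order G) → Set
IsCentre G σ c c′ = (c ≡ c′ × σ ≡ 0) ⊎ (Adj G c c′ ≡ true × σ ≡ 1)

MooreBallBound : Graph → (k δ M σ : ℕ) → Set
MooreBallBound G k δ M σ =
  ∀ c c′ → IsCentre G σ c c′ → M + (deg G c ∸ δ) ≤ Walks.count G (λ w → Walks.reach? G k c w ∨ Walks.reach? G k c′ w)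

module MooreBound (G : Graph) (g k δ M σ : ℕ) (girth : ∀ L → Cycle G L → g ≤ L) (min-deg : ∀ v → δ ≤ deg G v)
                  (1≤k : 1 ≤ k) (1≤δ : 1 ≤ δ) (g≡ : g ≡ 2 * k + 1 + σ)
                  (moore-vertex : σ ≡ 0 → M ≡ 1 + δ * powerSum (δ ∸ 1) k)
                  (moore-edge : σ ≡ 1 → M ≡ 2 + 2 * ((δ ∸ 1) * powerSum (δ ∸ 1) k)) where

  open Walks G

  private
    S : ℕ
    S = powerSum (δ ∸ 1) k

    1≤S : 1 ≤ S
    1≤S = subst (1 ≤_) (sym (powerSum-suc k 1≤k)) (m≤m+n 1 _)
      where
      powerSum-suc : ∀ k → 1 ≤ k → powerSum (δ ∸ 1) k ≡ 1 + sumℕ (k ∸ 1) (λ i → (δ ∸ 1) ^ suc i)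
      powerSum-suc (suc k) _ = refl

    n≤n*S : ∀ n → n ≤ n * S
    n≤n*S n = subst (_≤ n * S) (*-identityʳ n) (*-monoʳ-≤ n 1≤S)

    2k+1≤g : 2 * k + 1 ≤ g
    2k+1≤g = subst (2 * k + 1 ≤_) (sym g≡) (m≤m+n _ σ)

  Ball-size≥moore : MooreBallBound G k δ M σ
  Ball-size≥moore c c′ (inj₁ (c≡c′ , σ≡0)) = ≤-trans (begin
    M + excess                    ≡⟨ cong (_+ excess) (moore-vertex σ≡0) ⟩
    1 + δ * S + excess            ≤⟨ +-monoʳ-≤ (1 + δ * S) (n≤n*S excess) ⟩
    1 + (δ * S + excess * S)      ≡⟨ cong (1 +_) (*-distribʳ-+ S δ excess) ⟨
    1 + (δ + excess) * S          ≡⟨ cong (λ d → 1 + d * S) (m+[n∸m]≡n (min-deg c)) ⟩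
    1 + deg G c * S               ∎) (LayerSizes.Ball-size-vertex G g k δ girth c c′ (inj₁ c≡c′) 2k+1≤g 1≤k min-deg c≡c′)
    where
    open ≤-Reasoning
    excess : ℕ
    excess = deg G c ∸ δ
  Ball-size≥moore c c′ (inj₂ (cc′ , σ≡1)) = ≤-trans (begin
    M + excess                                        ≡⟨ cong (_+ excess) (moore-edge σ≡1) ⟩
    2 + 2 * ((δ ∸ 1) * S) + excess                    ≤⟨ +-monoʳ-≤ (2 + 2 * ((δ ∸ 1) * S)) (n≤n*S excess) ⟩
    2 + 2 * ((δ ∸ 1) * S) + excess * S                ≡⟨ regroup (δ ∸ 1) excess S ⟩
    2 + (((δ ∸ 1) + excess) + (δ ∸ 1)) * S
      ≤⟨ +-monoʳ-≤ 2 (*-monoˡ-≤ S (+-mono-≤ (≤-reflexive deg-c∸1) (∸-monoˡ-≤ 1 (min-deg c′)))) ⟩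
    2 + ((deg G c ∸ 1) + (deg G c′ ∸ 1)) * S          ∎)
    (LayerSizes.Ball-size-edge G g k δ girth c c′ (inj₂ (cc′ , 2k+2≤g)) 2k+1≤g 1≤k min-deg c≢c′ cc′)
    where
    open ≤-Reasoning
    excess : ℕ
    excess = deg G c ∸ δ
    c≢c′ : c ≢ c′
    c≢c′ refl = true≢false cc′ (irrfl G c)
    2k+2≤g : 2 * k + 2 ≤ g
    2k+2≤g = ≤-reflexive (sym (trans g≡ (trans (cong (2 * k + 1 +_) σ≡1) (+-assoc (2 * k) 1 1))))
    regroup : ∀ a e s → 2 + 2 * (a * s) + e * s ≡ 2 + ((a + e) + a) * s
    regroup = solve-∀
    deg-c∸1 : (δ ∸ 1) + excess ≡ deg G c ∸ 1
    deg-c∸1 = trans (sym (+-∸-comm excess 1≤δ)) (cong (_∸ 1) (m+[n∸m]≡n (min-deg c)))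

-- Arcs of ℤ/q of diameter 2k

module Arcs (q k σ : ℕ) (σ≤1 : σ ≤ 1) (6k+3<q : 6 * k + 3 < q)
            (f : ℕ → Bool) (f-periodic : ∀ i → f (i + q) ≡ f i)
            (f-close : ∀ i j → f i ≡ true → f j ≡ true → Modulo.Close q (2 * k) i j) where

  open Modulo q

  fσ : ℕ → Bool
  fσ i = f i ∨ f (i + σ)

  hits : ℕ
  hits = sumℕ q (𝟙 ∘ fσ)

  private
    small : ∀ {x} → x ≤ 6 * k + 3 → x < q
    small x≤ = ≤-<-trans x≤ 6k+3<q

    2k+1+4k+2≡6k+3 : 2 * k + 1 + (4 * k + 2) ≡ 6 * k + 3
    2k+1+4k+2≡6k+3 = solve (k ∷ [])

    2k+1+2k≡4k+1 : 2 * k + 1 + 2 * k ≡ 4 * k + 1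
    2k+1+2k≡4k+1 = solve (k ∷ [])

    4k+1+2k+2≡6k+3 : 4 * k + 1 + (2 * k + 2) ≡ 6 * k + 3
    4k+1+2k+2≡6k+3 = solve (k ∷ [])

    fσ-periodic : ∀ i → 𝟙 (fσ (i + q)) ≡ 𝟙 (fσ i)
    fσ-periodic i = cong 𝟙 (cong₂ _∨_ (f-periodic i) (trans (cong f (xy∙z≈xz∙y i q σ)) (f-periodic (i + σ))))

    f-false-up-to-q : (∀ t → t < q → f t ≡ false) → ∀ t → t ≤ q → f t ≡ false
    f-false-up-to-q none t t≤q with m≤n⇒m<n∨m≡n t≤q
    ... | inj₁ t<q  = none t t<q
    ... | inj₂ refl = trans (f-periodic 0) (none 0 (small z≤n))

    hits≡0 : (∀ t → t < q → f t ≡ false) → hits ≡ 0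
    hits≡0 none = trans (sumℕ-cong q (λ i i<q → cong 𝟙 (cong₂ _∨_ (none i i<q) (f-false-up-to-q none (i + σ) (i+σ≤q i<q)))))
                        (trans (sumℕ-const q 0) (*-zeroʳ q))
      where
      i+σ≤q : ∀ {i} → i < q → i + σ ≤ q
      i+σ≤q {i} i<q = ≤-trans (+-monoʳ-≤ i σ≤1) (subst (_≤ q) (+-comm 1 i) i<q)

  -- Rotate the cycle so that the positions hit by f form an interval [a, a + 2k] with a ≥ 1.
  module Rotated (i₀ : ℕ) (fi₀ : f i₀ ≡ true) where

    b : ℕ
    b = i₀ + q ∸ (2 * k + 1)

    h : ℕ → Bool
    h t = f (b + t)

    private
      2k+1<q : 2 * k + 1 < q
      2k+1<q = small (subst (2 * k + 1 ≤_) 2k+1+4k+2≡6k+3 (m≤m+n (2 * k + 1) (4 * k + 2)))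

      4k+1<q : 4 * k + 1 < q
      4k+1<q = small (subst (4 * k + 1 ≤_) 4k+1+2k+2≡6k+3 (m≤m+n (4 * k + 1) (2 * k + 2)))

      h-2k+1 : h (2 * k + 1) ≡ true
      h-2k+1 = trans (cong f (m∸n+n≡m (≤-trans (<⇒≤ 2k+1<q) (m≤n+m q i₀)))) (trans (f-periodic i₀) fi₀)

      h-close : ∀ t t′ → h t ≡ true → h t′ ≡ true → Close (2 * k) t t′
      h-close t t′ ht ht′ = Close-cancelˡ b (f-close (b + t) (b + t′) ht ht′)

      h-window : ∀ t → t ≤ q → h t ≡ true → 1 ≤ t × t ≤ 4 * k + 1
      h-window t t≤q ht with Close-window {2 * k} {2 * k + 1} (m<m+n (2 * k) z<s) (subst (_< q) (sym 2k+1+2k≡4k+1) 4k+1<q)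
                                          t≤q (h-close t (2 * k + 1) ht h-2k+1)
      ... | lo , hi = subst (_≤ t) (m+n∸m≡n (2 * k) 1) lo , subst (t ≤_) 2k+1+2k≡4k+1 hi

      t+2k<q : ∀ {t} → t ≤ 4 * k + 1 → t + 2 * k < q
      t+2k<q t≤ = small (≤-trans (+-monoˡ-≤ (2 * k) t≤)
                                 (subst (4 * k + 1 + 2 * k ≤_) 4k+1+2k+2≡6k+3 (+-monoʳ-≤ (4 * k + 1) (m≤m+n (2 * k) 2))))

      first : Σ[ a ∈ ℕ ] a < 2 * k + 2 × h a ≡ true × (∀ s → s < a → h s ≢ true)
      first with minimal-or-none (λ t → h t Bool.≟ true) (2 * k + 2)
      ... | inj₁ found = found
      ... | inj₂ none  = ⊥-elim (none (2 * k + 1) (≤-reflexive (sym (+-suc (2 * k) 1))) h-2k+1)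

    a : ℕ
    a = proj₁ first

    h-a : h a ≡ true
    h-a = proj₁ (proj₂ (proj₂ first))

    private
      a≤2k+1 : a ≤ 2 * k + 1
      a≤2k+1 = ≤-pred (subst (a <_) (+-suc (2 * k) 1) (proj₁ (proj₂ first)))

      a≤q : a ≤ q
      a≤q = ≤-trans a≤2k+1 (<⇒≤ 2k+1<q)

      1≤a : 1 ≤ a
      1≤a = proj₁ (h-window a a≤q h-a)

    h-interval : ∀ t → t ≤ q → h t ≡ true → a ≤ t × t ≤ a + 2 * k
    h-interval t t≤q ht = ≮⇒≥ (λ t<a → proj₂ (proj₂ (proj₂ first)) t t<a ht) ,
                          Close-lift (t+2k<q (proj₂ (h-window a a≤q h-a))) (t+2k<q (proj₂ (h-window t t≤q ht))) (h-close a t h-a ht)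

    fσ-interval : ∀ t → t < q → fσ (b + t) ≡ true → a ∸ σ ≤ t × t < suc (a + 2 * k)
    fσ-interval t t<q e with ∨-true {h t} e
    ... | inj₁ ht   = ≤-trans (m∸n≤m a σ) (proj₁ (h-interval t (<⇒≤ t<q) ht)) , s≤s (proj₂ (h-interval t (<⇒≤ t<q) ht))
    ... | inj₂ ht+σ = m≤n+o⇒m∸n≤o a σ (subst (a ≤_) (+-comm t σ) (proj₁ interval)) ,
                      s≤s (≤-trans (m≤m+n t σ) (proj₂ interval))
      where
      interval : a ≤ t + σ × t + σ ≤ a + 2 * k
      interval = h-interval (t + σ) (≤-trans (+-monoʳ-≤ t σ≤1) (subst (_≤ q) (+-comm 1 t) t<q))
                                    (subst (λ x → f x ≡ true) (+-assoc b t σ) ht+σ)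

    private
      hits-rotated : hits ≡ sumℕ q (λ t → 𝟙 (fσ (b + t)))
      hits-rotated = sym (sumℕ-rotate q (𝟙 ∘ fσ) fσ-periodic b)

      width : suc (a + 2 * k) ∸ (a ∸ σ) ≡ 2 * k + 1 + σ
      width = begin
        suc (a + 2 * k) ∸ (a ∸ σ)                    ≡⟨ cong (λ x → suc (x + 2 * k) ∸ (a ∸ σ)) (m∸n+n≡m (≤-trans σ≤1 1≤a)) ⟨
        suc (a ∸ σ + σ + 2 * k) ∸ (a ∸ σ)            ≡⟨ cong (_∸ (a ∸ σ)) (regroup (a ∸ σ) σ k) ⟩
        (a ∸ σ) + (2 * k + 1 + σ) ∸ (a ∸ σ)          ≡⟨ m+n∸m≡n (a ∸ σ) _ ⟩
        2 * k + 1 + σ                                 ∎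
        where
        open ≡-Reasoning
        regroup : ∀ x σ k → suc (x + σ + 2 * k) ≡ x + (2 * k + 1 + σ)
        regroup = solve-∀

    hits≤ : hits ≤ 2 * k + 1 + σ
    hits≤ = subst₂ _≤_ (sym hits-rotated) width (sumℕ-𝟙-interval q (a ∸ σ) (suc (a + 2 * k)) (fσ ∘ (b +_)) fσ-interval)

    hits-full : hits ≡ 2 * k + 1 + σ → h (a + 2 * k) ≡ true
    hits-full full with fσ (b + (a + 2 * k)) in e
    ... | false = ⊥-elim (<-irrefl refl (begin-strict
        hits                                ≡⟨ hits-rotated ⟩
        sumℕ q (λ t → 𝟙 (fσ (b + t)))      ≤⟨ sumℕ-𝟙-interval q (a ∸ σ) (a + 2 * k) (fσ ∘ (b +_)) before-end ⟩
        a + 2 * k ∸ (a ∸ σ)                 <⟨ ≤-reflexive (sym (+-∸-assoc 1 (≤-trans (m∸n≤m a σ) (m≤m+n a (2 * k))))) ⟩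
        suc (a + 2 * k) ∸ (a ∸ σ)           ≡⟨ trans width (sym full) ⟩
        hits                                ∎))
      where
      open ≤-Reasoning
      before-end : ∀ t → t < q → fσ (b + t) ≡ true → a ∸ σ ≤ t × t < a + 2 * k
      before-end t t<q ft with fσ-interval t t<q ft
      ... | lo , t<1+a+2k with m≤n⇒m<n∨m≡n (≤-pred t<1+a+2k)
      ...   | inj₁ t<a+2k = lo , t<a+2k
      ...   | inj₂ refl   = ⊥-elim (true≢false ft e)
    ... | true with ∨-true {h (a + 2 * k)} e
    ...   | inj₁ h-end = h-end
    ...   | inj₂ h-beyond with m≤n⇒m<n∨m≡n σ≤1
    ...     | inj₁ (s≤s z≤n) = subst (λ x → f x ≡ true) (+-identityʳ _) h-beyond
    ...     | inj₂ refl      = ⊥-elim (<-irrefl refl (subst (_≤ a + 2 * k) (+-comm (a + 2 * k) 1)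
                                 (proj₂ (h-interval (a + 2 * k + 1) a+2k+1≤q (subst (λ x → f x ≡ true) (+-assoc b _ 1) h-beyond)))))
      where
      a+2k+1≤q : a + 2 * k + 1 ≤ q
      a+2k+1≤q = <⇒≤ (small (≤-trans (+-monoˡ-≤ 1 (+-monoˡ-≤ (2 * k) a≤2k+1))
                                     (subst (2 * k + 1 + 2 * k + 1 ≤_) sum≡ (m≤m+n _ (2 * k + 1)))))
        where
        sum≡ : 2 * k + 1 + 2 * k + 1 + (2 * k + 1) ≡ 6 * k + 3
        sum≡ = solve (k ∷ [])

  private
    some-hit? : Dec (Σ[ i ∈ ℕ ] i < q × f i ≡ true)
    some-hit? = anyUpTo? (λ i → f i Bool.≟ true) q

    no-hit : ¬ (Σ[ i ∈ ℕ ] i < q × f i ≡ true) → ∀ t → t < q → f t ≡ false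
    no-hit none t t<q = ¬-not (λ ft → none (t , t<q , ft))

  hits≤ : hits ≤ 2 * k + 1 + σ
  hits≤ with some-hit?
  ... | yes (i₀ , _ , fi₀) = Rotated.hits≤ i₀ fi₀
  ... | no none            = subst (_≤ 2 * k + 1 + σ) (sym (hits≡0 (no-hit none))) z≤n

  hits-full⇒diameter : hits ≡ 2 * k + 1 + σ → Σ[ x ∈ ℕ ] f x ≡ true × f (x + 2 * k) ≡ true
  hits-full⇒diameter full with some-hit?
  ... | yes (i₀ , _ , fi₀) = b + a , h-a , subst (λ x → f x ≡ true) (sym (+-assoc b a (2 * k))) (hits-full full)
    where open Rotated i₀ fi₀
  ... | no none = ⊥-elim (0≢1+n (trans (sym (hits≡0 (no-hit none))) (trans full (trans (cong (_+ σ) (+-comm (2 * k) 1)) refl))))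

-- Isometric cycles, as periodic sequences: `adjacent` bounds distances in G by those in ℤ/q,
-- `faithful` bounds them from below.

record IsometricLoop (G : Graph) (q : ℕ) : Set where
  field
    vertex   : ℕ → Fin (order G)
    periodic : ∀ i → vertex (i + q) ≡ vertex i
    adjacent : ∀ i → Adj G (vertex i) (vertex (suc i)) ≡ true
    faithful : ∀ i j l → Walks.Reach G l (vertex i) (vertex j) → Modulo.Close q l i j

-- Double counting balls along an isometric loop

module DoubleCounting (G : Graph) (g k δ q M σ : ℕ) (min-deg : ∀ v → δ ≤ deg G v) (6k+3<q : 6 * k + 3 < q)
                      (σ≤1 : σ ≤ 1) (g≡ : g ≡ 2 * k + 1 + σ) (order≡ : g * order G ≡ q * M)
                      (Ball-size≥moore : MooreBallBound G k δ M σ)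
                      (loop : IsometricLoop G q) where

  open Walks G
  open Modulo q
  open IsometricLoop loop

  BallAt : ℕ → V → Bool
  BallAt i w = reach? k (vertex i) w ∨ reach? k (vertex (i + σ)) w

  excess : ℕ → ℕ
  excess i = deg G (vertex i) ∸ δ

  private
    BallAt-size : ∀ i → M + excess i ≤ count (BallAt i)
    BallAt-size i with m≤n⇒m<n∨m≡n σ≤1
    ... | inj₁ (s≤s z≤n) = Ball-size≥moore (vertex i) (vertex (i + σ)) (inj₁ (cong vertex (sym (+-identityʳ i)) , refl))
    ... | inj₂ refl      = Ball-size≥moore (vertex i) (vertex (i + 1))
                             (inj₂ (subst (λ j → Adj G (vertex i) (vertex j) ≡ true) (+-comm 1 i) (adjacent i) , refl))

    near : V → ℕ → Bool
    near w i = reach? k (vertex i) w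

    near-close : ∀ w i j → near w i ≡ true → near w j ≡ true → Close (2 * k) i j
    near-close w i j wi wj = Close-mono (≤-reflexive (cong (k +_) (sym (+-identityʳ k))))
                               (faithful i j (k + k) (Reach-trans (reach?-sound k wi) (Reach-sym (reach?-sound k wj))))

  module ArcsOf (w : V) = Arcs q k σ σ≤1 6k+3<q (near w) (λ i → cong (λ v → reach? k v w) (periodic i)) (near-close w)

  private
    hits : V → ℕ
    hits w = ArcsOf.hits w

    total : ℕ
    total = sumℕ q (λ i → count (BallAt i))

    total-by-vertices : sumFin N hits ≡ total
    total-by-vertices = sumFin-sumℕ-swap N q (λ w i → 𝟙 (BallAt i w))

    hits≤g : ∀ w → hits w ≤ g
    hits≤g w = subst (hits w ≤_) (sym g≡) (ArcsOf.hits≤ w)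

    total≤ : total ≤ q * M
    total≤ = subst (_≤ q * M) total-by-vertices (≤-trans (sumFin-≤-const N g hits≤g) (≤-reflexive (trans (*-comm N g) order≡)))

    total≥ : q * M + sumℕ q excess ≤ total
    total≥ = subst (_≤ total) (trans (sumℕ-+ q (λ _ → M) excess) (cong (_+ sumℕ q excess) (sumℕ-const q M)))
                   (sumℕ-mono q (λ i _ → BallAt-size i))

    no-excess : sumℕ q excess ≡ 0
    no-excess = n≤0⇒n≡0 (+-cancelˡ-≤ (q * M) _ _ (≤-trans total≥ (≤-trans total≤ (≤-reflexive (sym (+-identityʳ (q * M)))))))

  deg-on-loop : ∀ i → i < q → deg G (vertex i) ≡ δ
  deg-on-loop i i<q = ≤-antisym (m∸n≡0⇒m≤n (sumℕ≡0⇒≡0 q excess no-excess i i<q)) (min-deg (vertex i))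

  private
    hits≡g : ∀ w → hits w ≡ g
    hits≡g = sumFin-tight N hits g hits≤g (≤-trans (≤-reflexive (trans (*-comm N g) order≡))
                                          (≤-trans (m≤m+n (q * M) _) (≤-trans total≥ (≤-reflexive (sym total-by-vertices)))))

  -- Equality throughout: every vertex lies in exactly g of the balls, so the positions
  -- within distance k of it span a full arc of length 2k.
  spanning-arc : ∀ w → Σ[ x ∈ ℕ ] Reach k (vertex x) w × Reach k (vertex (x + 2 * k)) w
  spanning-arc w with ArcsOf.hits-full⇒diameter w (trans (hits≡g w) g≡)
  ... | x , wx , wx+2k = x , reach?-sound k wx , reach?-sound k wx+2k

-- From Fin q-indexed cycles to periodic sequences

module Unrolling (G : Graph) (q : ℕ) (2≤q : 2 ≤ q) where

  open Walks G
  open Modulo q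

  instance
    q-nonZero : NonZero q
    q-nonZero = >-nonZero (≤-trans (s≤s z≤n) 2≤q)

  toℕ-mod : ∀ i → toℕ (i mod q) ≡ i % q
  toℕ-mod i = toℕ-fromℕ< (m%n<n i q)

  mod-periodic : ∀ i → (i + q) mod q ≡ i mod q
  mod-periodic i = toℕ-injective (trans (toℕ-mod (i + q)) (trans ([m+n]%n≡m%n i q) (sym (toℕ-mod i))))

  ≡ₘ-% : ∀ i → i ≡ₘ i % q
  ≡ₘ-% i = 0 , i / q , trans (+-identityʳ i) (m≡m%n+[m/n]*n i q)

  private
    suc-% : ∀ i → suc i % q ≡ suc (i % q) % q
    suc-% i = trans (%-distribˡ-+ 1 i q) (cong (λ r → (r + i % q) % q) (m<n⇒m%n≡m 2≤q))

  unroll-adjacent : (F : Fin q → V) →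
                    (∀ (p p′ : Fin q) → suc (toℕ p) ≡ toℕ p′ → A (F p) (F p′) ≡ true) →
                    (∀ (p p′ : Fin q) → toℕ p ≡ q ∸ 1 → toℕ p′ ≡ 0 → A (F p) (F p′) ≡ true) →
                    ∀ i → A (F (i mod q)) (F (suc i mod q)) ≡ true
  unroll-adjacent F next close i with m≤n⇒m<n∨m≡n (m%n<n i q)
  ... | inj₁ 1+r<q = next (i mod q) (suc i mod q)
                       (trans (cong suc (toℕ-mod i)) (sym (trans (toℕ-mod (suc i)) (trans (suc-% i) (m<n⇒m%n≡m 1+r<q)))))
  ... | inj₂ 1+r≡q = close (i mod q) (suc i mod q) (trans (toℕ-mod i) (cong pred 1+r≡q))
                       (trans (toℕ-mod (suc i)) (trans (suc-% i) (trans (cong (_% q) 1+r≡q) (n%n≡0 q))))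

  private
    cycDist≤⇒Close-ordered : ∀ i j l → i % q ≤ j % q → ∣ i % q - j % q ∣ ⊓ (q ∸ ∣ i % q - j % q ∣) ≤ l → Close l i j
    cycDist≤⇒Close-ordered i j l ri≤rj dist≤l = by-direction (≤-total gap (q ∸ gap))
      where
      gap : ℕ
      gap = j % q ∸ i % q
      gap≤l : gap ⊓ (q ∸ gap) ≤ l
      gap≤l = subst (λ x → x ⊓ (q ∸ x) ≤ l) (trans (∣-∣-comm (i % q) (j % q)) (m≤n⇒∣n-m∣≡n∸m ri≤rj)) dist≤l
      around : j % q + (q ∸ gap) ≡ i % q + q
      around = begin
        j % q + (q ∸ gap)          ≡⟨ cong (_+ (q ∸ gap)) (m+[n∸m]≡n ri≤rj) ⟨
        i % q + gap + (q ∸ gap)    ≡⟨ +-assoc (i % q) gap (q ∸ gap) ⟩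
        i % q + (gap + (q ∸ gap))  ≡⟨ cong (i % q +_) (m+[n∸m]≡n (≤-trans (m∸n≤m (j % q) (i % q)) (<⇒≤ (m%n<n j q)))) ⟩
        i % q + q                  ∎
        where open ≡-Reasoning
      forward : i + gap ≡ₘ j
      forward = ≡ₘ-trans (≡ₘ-+ʳ gap (≡ₘ-% i)) (≡ₘ-trans (≡⇒≡ₘ (m+[n∸m]≡n ri≤rj)) (≡ₘ-sym (≡ₘ-% j)))
      backward : j + (q ∸ gap) ≡ₘ i
      backward = ≡ₘ-trans (≡ₘ-+ʳ (q ∸ gap) (≡ₘ-% j)) (≡ₘ-trans (≡⇒≡ₘ around) (≡ₘ-trans (x+q≡ₘx (i % q)) (≡ₘ-sym (≡ₘ-% i))))
      by-direction : gap ≤ q ∸ gap ⊎ q ∸ gap ≤ gap → Close l i j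
      by-direction (inj₁ gap≤) = gap     , ≤-trans (≤-reflexive (sym (m≤n⇒m⊓n≡m gap≤))) gap≤l , inj₁ forward
      by-direction (inj₂ ≤gap) = q ∸ gap , ≤-trans (≤-reflexive (sym (m≥n⇒m⊓n≡n ≤gap))) gap≤l , inj₂ backward

  cycDist≤⇒Close : ∀ i j l → cycDist q (i mod q) (j mod q) ≤ l → Close l i j
  cycDist≤⇒Close i j l dist≤l = by-order (≤-total (i % q) (j % q))
    where
    dist≤ : ∣ i % q - j % q ∣ ⊓ (q ∸ ∣ i % q - j % q ∣) ≤ l
    dist≤ = subst (_≤ l) (cong₂ (λ x y → ∣ x - y ∣ ⊓ (q ∸ ∣ x - y ∣)) (toℕ-mod i) (toℕ-mod j)) dist≤l
    by-order : i % q ≤ j % q ⊎ j % q ≤ i % q → Close l i j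
    by-order (inj₁ ri≤rj) = cycDist≤⇒Close-ordered i j l ri≤rj dist≤
    by-order (inj₂ rj≤ri) = Close-sym (cycDist≤⇒Close-ordered j i l rj≤ri
                                         (subst (λ x → x ⊓ (q ∸ x) ≤ l) (∣-∣-comm (i % q) (j % q)) dist≤))

  isometric⇒loop : (C : Cycle G q) → Isometric G C → IsometricLoop G q
  isometric⇒loop C isometric = record
    { vertex   = λ i → vert C (i mod q)
    ; periodic = λ i → cong (vert C) (mod-periodic i)
    ; adjacent = unroll-adjacent (vert C) (next C) (close C)
    ; faithful = λ i j l (m , m≤l , w) →
        cycDist≤⇒Close i j l (≤-trans (≮⇒≥ (λ m<d → proj₂ (isometric (i mod q) (j mod q)) m m<d w)) m≤l)
    }

6k+3<q⇒2≤q : ∀ {k q} → 6 * k + 3 < q → 2 ≤ q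
6k+3<q⇒2≤q {k} 6k+3<q = ≤-trans (s≤s (s≤s z≤n)) (≤-trans (m≤n+m 3 (6 * k)) (<⇒≤ 6k+3<q))

-- Projection onto an extremal loop, and rerouting it through any vertex

module Rerouting (G : Graph) (g k δ q M σ : ℕ) (min-deg : ∀ v → δ ≤ deg G v) (6k+3<q : 6 * k + 3 < q)
                 (σ≤1 : σ ≤ 1) (g≡ : g ≡ 2 * k + 1 + σ) (order≡ : g * order G ≡ q * M)
                 (Ball-size≥moore : MooreBallBound G k δ M σ)
                 (D : IsometricLoop G q) where

  open Walks G
  open Modulo q

  module Counting = DoubleCounting G g k δ q M σ min-deg 6k+3<q σ≤1 g≡ order≡ Ball-size≥moore

  private
    open IsometricLoop D renaming (vertex to d; adjacent to d-adjacent; faithful to d-faithful)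

    4k+2k+3≡6k+3 : 2 * k + 2 * k + (2 * k + 3) ≡ 6 * k + 3
    4k+2k+3≡6k+3 = solve (k ∷ [])

    3[2k]+3≡6k+3 : suc (3 * (2 * k) + 2) ≡ 6 * k + 3
    3[2k]+3≡6k+3 = solve (k ∷ [])

    4k<q : 2 * k + 2 * k < q
    4k<q = ≤-<-trans (subst (2 * k + 2 * k ≤_) 4k+2k+3≡6k+3 (m≤m+n (2 * k + 2 * k) (2 * k + 3))) 6k+3<q

    6k+2<q : 3 * (2 * k) + 2 < q
    6k+2<q = ≤-<-trans (subst (3 * (2 * k) + 2 ≤_) 3[2k]+3≡6k+3 (n≤1+n _)) 6k+3<q

  π : V → ℕ
  π w = proj₁ (Counting.spanning-arc D w)

  π-start : ∀ w → Reach k (d (π w)) w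
  π-start w = proj₁ (proj₂ (Counting.spanning-arc D w))

  π-end : ∀ w → Reach k (d (π w + 2 * k)) w
  π-end w = proj₂ (proj₂ (Counting.spanning-arc D w))

  π-edge : ∀ {x y} → A x y ≡ true → Close 1 (π x) (π y)
  π-edge {x} {y} xy = Close-arc-starts 6k+2<q (via (π-start x) (π-start y)) (via (π-start x) (π-end y)) (via (π-end x) (π-start y))
    where
    via : ∀ {i j} → Reach k (d i) x → Reach k (d j) y → Close (2 * k + 1) i j
    via {i} {j} ix jy = d-faithful i j (2 * k + 1)
      (Reach-mono (≤-reflexive k+1+k≡2k+1) (Reach-trans (Reach-trans ix (Reach-edge xy)) (Reach-sym jy)))
      where
      k+1+k≡2k+1 : k + 1 + k ≡ 2 * k + 1
      k+1+k≡2k+1 = solve (k ∷ [])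

  π-walk : ∀ {x y m} → Walk G x y m → Close m (π x) (π y)
  π-walk here          = Close-refl
  π-walk (step xz zy)  = Close-trans (π-edge xz) (π-walk zy)

  π-Reach : ∀ {x y l} → Reach l x y → Close l (π x) (π y)
  π-Reach (m , m≤l , w) = Close-mono m≤l (π-walk w)

  π-on-loop : ∀ t → π (d t) + k ≡ₘ t
  π-on-loop t = Close-between {s = k} (subst (k ≤_) (cong (k +_) (sym (+-identityʳ k))) (m≤m+n k k)) 4k<q
    (Close-sym (d-faithful (π (d t)) t k (π-start (d t))))
    (subst (λ l → Close l t (π (d t) + 2 * k)) (sym 2k∸k≡k) (Close-sym (d-faithful (π (d t) + 2 * k) t k (π-end (d t)))))
    where
    2k∸k≡k : 2 * k ∸ k ≡ k
    2k∸k≡k = trans (cong (λ x → k + x ∸ k) (+-identityʳ k)) (m+n∸m≡n k k)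

  open Unrolling G q (6k+3<q⇒2≤q {k} 6k+3<q)

  -- Replacing the arc d a, …, d (a + 2k) by a path of the same length through x gives another
  -- isometric loop, because π still sends its t-th vertex to a + t - k.
  module Through {x a m₁ m₂} (w₁ : Walk G (d a) x m₁) (w₂ : Walk G x (d (a + 2 * k)) m₂)
                 (m₁≤k : m₁ ≤ k) (m₂≤k : m₂ ≤ k) where

    private
      2k≡k+k : 2 * k ≡ k + k
      2k≡k+k = cong (k +_) (+-identityʳ k)

      2k≤m₁+m₂ : 2 * k ≤ m₁ + m₂
      2k≤m₁+m₂ = Close-offset 4k<q (d-faithful a (a + 2 * k) (m₁ + m₂) (m₁ + m₂ , ≤-refl , w₁ ++ʷ w₂))

      m₁≡k : m₁ ≡ k
      m₁≡k = ≤-antisym m₁≤k (+-cancelʳ-≤ k k m₁ (≤-trans (≤-reflexive (sym 2k≡k+k))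
                                                         (≤-trans 2k≤m₁+m₂ (+-monoʳ-≤ m₁ m₂≤k))))

      m₁+m₂≡2k : m₁ + m₂ ≡ 2 * k
      m₁+m₂≡2k = ≤-antisym (≤-trans (+-mono-≤ m₁≤k m₂≤k) (≤-reflexive (sym 2k≡k+k))) 2k≤m₁+m₂

      r : ℕ → V
      r = vertexAt (w₁ ++ʷ w₂)

      r-0 : r 0 ≡ d a
      r-0 = vertexAt-0 (w₁ ++ʷ w₂)

      r-k : r k ≡ x
      r-k = subst (λ t → r t ≡ x) m₁≡k (trans (vertexAt-++ʷ w₁ w₂ m₁ ≤-refl) (vertexAt-end w₁ m₁ ≤-refl))

      r-2k : r (2 * k) ≡ d (a + 2 * k)
      r-2k = vertexAt-end (w₁ ++ʷ w₂) (2 * k) (≤-reflexive m₁+m₂≡2k)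

      r-adj : ∀ t → t < 2 * k → A (r t) (r (suc t)) ≡ true
      r-adj t t<2k = vertexAt-adj (w₁ ++ʷ w₂) t (subst (t <_) (sym m₁+m₂≡2k) t<2k)

      spliced : ℕ → V
      spliced t with t ≤? 2 * k
      ... | yes _ = r t
      ... | no _  = d (a + t)

      spliced-r : ∀ t → t ≤ 2 * k → spliced t ≡ r t
      spliced-r t t≤2k with t ≤? 2 * k
      ... | yes _    = refl
      ... | no t≰2k  = ⊥-elim (t≰2k t≤2k)

      spliced-d : ∀ t → 2 * k < t → spliced t ≡ d (a + t)
      spliced-d t 2k<t with t ≤? 2 * k
      ... | yes t≤2k = ⊥-elim (<⇒≱ 2k<t t≤2k)
      ... | no _     = refl

      d-adj : ∀ t → A (d (a + t)) (d (a + suc t)) ≡ true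
      d-adj t = subst (λ i → A (d (a + t)) (d i) ≡ true) (sym (+-suc a t)) (d-adjacent (a + t))

      spliced-adj : ∀ t → A (spliced t) (spliced (suc t)) ≡ true
      spliced-adj t with <-cmp t (2 * k)
      ... | tri< t<2k _ _ = subst₂ (λ u v → A u v ≡ true) (sym (spliced-r t (<⇒≤ t<2k))) (sym (spliced-r (suc t) t<2k)) (r-adj t t<2k)
      ... | tri≈ _ refl _ = subst₂ (λ u v → A u v ≡ true) (sym (trans (spliced-r t ≤-refl) r-2k))
                                                         (sym (spliced-d (suc t) ≤-refl)) (d-adj t)
      ... | tri> _ _ 2k<t = subst₂ (λ u v → A u v ≡ true) (sym (spliced-d t 2k<t)) (sym (spliced-d (suc t) (m<n⇒m<1+n 2k<t))) (d-adj t)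

      2k<q-1 : 2 * k < q ∸ 1
      2k<q-1 = m+n≤o⇒m≤o∸n (suc (2 * k)) (≤-trans (subst (suc (2 * k) + 1 ≤_) sum≡ (m≤m+n _ (4 * k + 1))) (<⇒≤ 6k+3<q))
        where
        sum≡ : suc (2 * k) + 1 + (4 * k + 1) ≡ 6 * k + 3
        sum≡ = solve (k ∷ [])

      spliced-wraps : A (spliced (q ∸ 1)) (spliced 0) ≡ true
      spliced-wraps = subst₂ (λ u v → A u v ≡ true) (sym (spliced-d (q ∸ 1) 2k<q-1))
                        (trans (cong d (cong (a +_) (m+[n∸m]≡n (≤-trans (s≤s z≤n) (6k+3<q⇒2≤q {k} 6k+3<q)))))
                               (trans (periodic a) (sym (trans (spliced-r 0 z≤n) r-0))))
                        (d-adj (q ∸ 1))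

      F : Fin q → V
      F p = spliced (toℕ p)

      π-r : ∀ t → t ≤ 2 * k → a + t ≡ₘ π (r t) + k
      π-r t t≤2k = Close-between t≤2k 4k<q near-start near-end
        where
        near-start : Close t (π (r t) + k) a
        near-start = Close-resp-≡ₘ ≡ₘ-refl (subst (λ v → π v + k ≡ₘ a) (sym r-0) (π-on-loop a))
                       (Close-+ʳ k (Close-sym (π-Reach (Reach-along r z≤n t≤2k r-adj))))
        near-end : Close (2 * k ∸ t) (π (r t) + k) (a + 2 * k)
        near-end = Close-resp-≡ₘ ≡ₘ-refl (subst (λ v → π v + k ≡ₘ a + 2 * k) (sym r-2k) (π-on-loop (a + 2 * k)))
                     (Close-+ʳ k (π-Reach (Reach-along r t≤2k ≤-refl r-adj)))

      π-spliced : ∀ t → π (spliced t) + k ≡ₘ a + t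
      π-spliced t with t ≤? 2 * k
      ... | yes t≤2k = ≡ₘ-sym (π-r t t≤2k)
      ... | no _     = π-on-loop (a + t)

      π-F : ∀ s → π (F (s mod q)) + k ≡ₘ a + s
      π-F s = ≡ₘ-trans (π-spliced (toℕ (s mod q))) (≡ₘ-+ˡ a (subst (_≡ₘ s) (sym (toℕ-mod s)) (≡ₘ-sym (≡ₘ-% s))))

    rerouted : IsometricLoop G q
    rerouted = record
      { vertex   = λ s → F (s mod q)
      ; periodic = λ s → cong F (mod-periodic s)
      ; adjacent = unroll-adjacent F (λ p p′ e → subst (λ t → A (F p) (spliced t) ≡ true) e (spliced-adj (toℕ p)))
                                     (λ p p′ e₁ e₂ → subst₂ (λ s t → A (spliced s) (spliced t) ≡ true)
                                                              (sym e₁) (sym e₂) spliced-wraps)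
      ; faithful = λ i j l w → Close-cancelˡ a (Close-resp-≡ₘ (π-F i) (π-F j) (Close-+ʳ k (π-Reach w)))
      }

    private
      k<q : k < q
      k<q = ≤-<-trans (subst (k ≤_) k+5k+3≡6k+3 (m≤m+n k (5 * k + 3))) 6k+3<q
        where
        k+5k+3≡6k+3 : k + (5 * k + 3) ≡ 6 * k + 3
        k+5k+3≡6k+3 = solve (k ∷ [])

    x-on-rerouted : IsometricLoop.vertex rerouted k ≡ x
    x-on-rerouted = trans (cong spliced toℕ-k-mod) (trans (spliced-r k (m≤m+n k (k + 0))) r-k)
      where
      toℕ-k-mod : toℕ (k mod q) ≡ k
      toℕ-k-mod = trans (toℕ-mod k) (m<n⇒m%n≡m k<q)

    deg≡δ : deg G x ≡ δ
    deg≡δ = subst (λ v → deg G v ≡ δ) x-on-rerouted (Counting.deg-on-loop rerouted k k<q)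

  every-deg≡δ : ∀ x → deg G x ≡ δ
  every-deg≡δ x with π-start x | Reach-sym (π-end x)
  ... | m₁ , m₁≤k , w₁ | m₂ , m₂≤k , w₂ = Through.deg≡δ w₁ w₂ m₁≤k m₂≤k

-- Parity of the girth

sumFrom≡sumℕ : ∀ a m f → sumFrom a m f ≡ sumℕ m (λ i → f (a + i))
sumFrom≡sumℕ a zero    f = refl
sumFrom≡sumℕ a (suc m) f = cong₂ _+_ (cong f (sym (+-identityʳ a)))
                                     (trans (sumFrom≡sumℕ (suc a) m f) (sumℕ-cong m (λ i _ → cong f (sym (+-suc a i)))))

record GirthParity (g δ : ℕ) : Set where
  field
    σ            : ℕ
    σ≤1          : σ ≤ 1
    g≡           : g ≡ 2 * kOf g + 1 + σ
    1≤k          : 1 ≤ kOf g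
    moore-vertex : σ ≡ 0 → moore δ g ≡ 1 + δ * powerSum (δ ∸ 1) (kOf g)
    moore-edge   : σ ≡ 1 → moore δ g ≡ 2 + 2 * ((δ ∸ 1) * powerSum (δ ∸ 1) (kOf g))

odd-or-even : ∀ g → Σ[ m ∈ ℕ ] (g ≡ 1 + m * 2 ⊎ g ≡ m * 2)
odd-or-even zero    = 0 , inj₂ refl
odd-or-even (suc g) with odd-or-even g
... | m , inj₁ g≡1+2m = suc m , inj₂ (cong suc g≡1+2m)
... | m , inj₂ g≡2m   = m , inj₁ (cong suc g≡2m)

girthParity-odd : ∀ δ m → 3 ≤ 1 + m * 2 → GirthParity (1 + m * 2) δ
girthParity-odd δ m 3≤g = record
  { σ            = 0
  ; σ≤1          = z≤n
  ; g≡           = trans g≡2m+1 (cong (λ x → 2 * x + 1 + 0) (sym k≡m))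
  ; 1≤k          = subst (1 ≤_) (sym k≡m) (1≤m m 3≤g)
  ; moore-vertex = λ _ → trans (moore-odd ([m+kn]%n≡m%n 1 m 2))
                             (cong (1 +_) (trans (sumFrom≡sumℕ 0 k _) (sumℕ-*ˡ k δ ((δ ∸ 1) ^_))))
  ; moore-edge   = λ ()
  }
  where
  k : ℕ
  k = kOf (1 + m * 2)
  g≡2m+1 : 1 + m * 2 ≡ 2 * m + 1 + 0
  g≡2m+1 = solve (m ∷ [])
  k≡m : k ≡ m
  k≡m = half m
    where
    half : ∀ m → ⌊ m * 2 /2⌋ ≡ m
    half zero    = refl
    half (suc m) = cong suc (half m)
  1≤m : ∀ m → 3 ≤ 1 + m * 2 → 1 ≤ m
  1≤m zero    (s≤s ())
  1≤m (suc m) _ = s≤s z≤n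
  moore-odd : (1 + m * 2) % 2 ≡ 1 → moore δ (1 + m * 2) ≡ 1 + sumFrom 0 k (λ i → δ * (δ ∸ 1) ^ i)
  moore-odd odd rewrite odd = refl

girthParity-even : ∀ δ m → 3 ≤ suc m * 2 → GirthParity (suc m * 2) δ
girthParity-even δ m 3≤g = record
  { σ            = 1
  ; σ≤1          = ≤-refl
  ; g≡           = trans g≡2m+2 (cong (λ x → 2 * x + 1 + 1) (sym k≡m))
  ; 1≤k          = subst (1 ≤_) (sym k≡m) (1≤m m 3≤g)
  ; moore-vertex = λ ()
  ; moore-edge   = λ _ → trans (moore-even (m*n%n≡0 (suc m) 2)) (cong (2 +_) (begin
      sumFrom 1 k (λ i → 2 * (δ ∸ 1) ^ i)          ≡⟨ sumFrom≡sumℕ 1 k _ ⟩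
      sumℕ k (λ i → 2 * ((δ ∸ 1) * (δ ∸ 1) ^ i))   ≡⟨ sumℕ-*ˡ k 2 _ ⟩
      2 * sumℕ k (λ i → (δ ∸ 1) * (δ ∸ 1) ^ i)     ≡⟨ cong (2 *_) (sumℕ-*ˡ k (δ ∸ 1) _) ⟩
      2 * ((δ ∸ 1) * powerSum (δ ∸ 1) k)           ∎))
  }
  where
  open ≡-Reasoning
  k : ℕ
  k = kOf (suc m * 2)
  g≡2m+2 : suc m * 2 ≡ 2 * m + 1 + 1
  g≡2m+2 = solve (m ∷ [])
  k≡m : k ≡ m
  k≡m = half m
    where
    half : ∀ m → ⌊ 1 + m * 2 /2⌋ ≡ m
    half zero    = refl
    half (suc m) = cong suc (half m)
  1≤m : ∀ m → 3 ≤ suc m * 2 → 1 ≤ m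
  1≤m zero    (s≤s (s≤s ()))
  1≤m (suc m) _ = s≤s z≤n
  moore-even : (suc m * 2) % 2 ≡ 0 → moore δ (suc m * 2) ≡ 2 + sumFrom 1 k (λ i → 2 * (δ ∸ 1) ^ i)
  moore-even even rewrite even = refl

girthParity : ∀ g δ → 3 ≤ g → GirthParity g δ
girthParity g δ 3≤g with odd-or-even g
... | m     , inj₁ refl = girthParity-odd δ m 3≤g
... | zero  , inj₂ refl = ⊥-elim (<⇒≱ 3≤g z≤n)
... | suc m , inj₂ refl = girthParity-even δ m 3≤g

proposition20 : (G : Graph) (g δ q : ℕ) → Equatorial G g δ q → Regular G
proposition20 G g δ q equatorial u v = trans (deg≡δ u) (sym (deg≡δ v))
  where
  open Equatorial equatorial
  open GirthParity (girthParity g δ g≥3)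
  k : ℕ
  k = kOf g
  ball≥moore : MooreBallBound G k δ (moore δ g) σ
  ball≥moore = MooreBound.Ball-size≥moore G g k δ (moore δ g) σ (proj₂ girth) (proj₂ mindeg) 1≤k
                                          (≤-trans (s≤s z≤n) δ≥2) g≡ moore-vertex moore-edge
  loop : IsometricLoop G q
  loop = Unrolling.isometric⇒loop G q (6k+3<q⇒2≤q {k} qbig) (proj₁ (proj₁ equat)) (proj₂ (proj₁ equat))
  deg≡δ : ∀ x → deg G x ≡ δ
  deg≡δ = Rerouting.every-deg≡δ G g k δ q (moore δ g) σ (proj₂ mindeg) qbig σ≤1 g≡ ord ball≥moore loop
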